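{- For integers $n\ge k\ge 0$ and $r\ge0$, $$E(n,k,r)=\frac{1}{P(n,k)}\sum_{\substack{n_1+\dots+n_{r+1}=n-r}}\ \sum_{\substack{k_1+\dots+k_{r+1}=k-r}}\ \prod_{i=1}^{r+1}\binom{n_i}{k_i}^2,$$ where the sums run over tuples of nonnegative integers.
   Context: $P(n,k)=n(n-1)\cdots(n-k+1)$. $E(n,k,r)$ is the expected value, over uniformly random $\pi\in S_n$, of the number of pairs $(R,T)$ where $R$ is a set of $r$ fixed points of $\pi$ and $T$ is the index set of an increasing subsequence of $\pi$ of length $k$ (a set $\{i_1<\dots<i_k\}$ with $\pi(i_1)<\dots<\pi(i_k)$) with $R\subseteq T$. -}

module Defs where

open import Data.Bool using (true)
open import Data.Nat using (ℕ; zero; suc; _+_; _*_; _∸_; _^_; _≤_; _<_; _≤ᵇ_; s≤s; z≤n; NonZero; _!; >-nonZero)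
open import Data.Nat.Properties using (≤⇒≤ᵇ; _!≢0; m*n≢0; m<n⇒0<n∸m; ≤-trans; n≤1+n; ≤-refl)
open import Data.Nat.Combinatorics using (_P_; _C_)
open import Data.Nat.Combinatorics.Base using (_P′_)
open import Data.Fin using (Fin) renaming (_<_ to _<ᶠ_; _≟_ to _≟ᶠ_; _<?_ to _<ᶠ?_)
open import Data.Fin.Properties using (all?)
open import Data.Fin.Subset using (Subset; _∈_; _⊆_; ∣_∣)
open import Data.Fin.Subset.Properties using (_∈?_; _⊆?_)
open import Data.Vec using (Vec; []; _∷_; lookup)
open import Data.Vec.Functional using () 
open import Data.List using (List; []; _∷_; map; concatMap; filter; length; upTo; cartesianProduct; allFin)
open import Data.Product using (_×_; _,_; proj₁; proj₂)
open import Data.Nat.ListAction using (sum)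
open import Data.Integer using (+_)
open import Data.Rational using (ℚ; _/_)
open import Relation.Nullary.Decidable using (Dec; _→-dec_; _×-dec_)
open import Relation.Binary.PropositionalEquality using (_≡_)
open import Data.Nat using (_≟_)
open import Data.Bool.Properties using (T?)

allVecs : ∀ {A : Set} → List A → (m : ℕ) → List (Vec A m)
allVecs xs zero    = [] ∷ []
allVecs xs (suc m) = concatMap (λ x → map (x ∷_) (allVecs xs m)) xs

-- a permutation π ∈ S_n, given by its table of values (π i = lookup π i)
Injective : ∀ {n} → Vec (Fin n) n → Set
Injective {n} π = ∀ (i j : Fin n) → lookup π i ≡ lookup π j → i ≡ j

injective? : ∀ {n} (π : Vec (Fin n) n) → Dec (Injective π)
injective? π = all? λ i → all? λ j → (lookup π i ≟ᶠ lookup π j) →-dec (i ≟ᶠ j)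

-- S_n: the injective self-maps of Fin n (each listed exactly once)
Sym : (n : ℕ) → List (Vec (Fin n) n)
Sym n = filter injective? (allVecs (allFin n) n)

allSubsets : (n : ℕ) → List (Subset n)
allSubsets n = allVecs (Data.List._∷_ Data.Fin.Subset.outside (Data.List._∷_ Data.Fin.Subset.inside [])) n
  where import Data.Fin.Subset

FixedSet : ∀ {n} → Vec (Fin n) n → Subset n → Set
FixedSet {n} π R = ∀ (i : Fin n) → i ∈ R → lookup π i ≡ i

IncreasingSet : ∀ {n} → Vec (Fin n) n → Subset n → Set
IncreasingSet {n} π T =
  ∀ (i j : Fin n) → i ∈ T → j ∈ T → i <ᶠ j → lookup π i <ᶠ lookup π j

Good : ∀ {n} → ℕ → ℕ → Vec (Fin n) n → Subset n × Subset n → Set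
Good k r π (R , T) =
  (∣ R ∣ ≡ r) × FixedSet π R × (∣ T ∣ ≡ k) × IncreasingSet π T × (R ⊆ T)

good? : ∀ {n} k r (π : Vec (Fin n) n) (RT : Subset n × Subset n) → Dec (Good k r π RT)
good? k r π (R , T) =
  (∣ R ∣ ≟ r)
  ×-dec (all? λ i → (i ∈? R) →-dec (lookup π i ≟ᶠ i))
  ×-dec (∣ T ∣ ≟ k)
  ×-dec (all? λ i → all? λ j → (i ∈? T) →-dec ((j ∈? T) →-dec
          ((i <ᶠ? j) →-dec (lookup π i <ᶠ? lookup π j))))
  ×-dec (R ⊆? T)

count : ∀ {n} → ℕ → ℕ → Vec (Fin n) n → ℕ
count {n} k r π = length (filter (good? k r π) (cartesianProduct (allSubsets n) (allSubsets n)))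

-- E(n,k,r): average of count over the uniform distribution on S_n
E : ℕ → ℕ → ℕ → ℚ
E n k r = ((+ sum (map (count k r) (Sym n))) / (n !)) {{n !≢0}}

compositions : (p : ℕ) → ℕ → List (Vec ℕ p)
compositions zero    zero    = [] ∷ []
compositions zero    (suc m) = []
compositions (suc p) m = concatMap (λ a → map (a ∷_) (compositions p (m ∸ a))) (upTo (suc m))

-- weak compositions of the integer m - r into p parts (none if m < r)
compositionsSub : (p m r : ℕ) → List (Vec ℕ p)
compositionsSub p m r with r ≤ᵇ m
... | true  = compositions p (m ∸ r)
... | _     = []

prodBinom² : ∀ {p} → Vec ℕ p → Vec ℕ p → ℕ
prodBinom² []       []       = 1
prodBinom² (a ∷ as) (b ∷ bs) = (a C b) ^ 2 * prodBinom² as bs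

RHSsum : ℕ → ℕ → ℕ → ℕ
RHSsum n k r =
  sum (map (λ ns → sum (map (λ ks → prodBinom² ns ks) (compositionsSub (suc r) k r)))
           (compositionsSub (suc r) n r))

P′≢0 : ∀ n k → k ≤ n → NonZero (n P′ k)
P′≢0 n zero    _   = _
P′≢0 n (suc k) k<n = m*n≢0 (n ∸ k) (n P′ k)
  {{>-nonZero (m<n⇒0<n∸m k<n)}} {{P′≢0 n k (≤-trans (n≤1+n k) k<n)}}

P≢0 : ∀ {n k} → k ≤ n → NonZero (n P k)
P≢0 {n} {k} k≤n with k ≤ᵇ n | ≤⇒≤ᵇ k≤n
... | true | _ = P′≢0 n k k≤n

-- Swap the sums: n! E(n,k,r) counts triples (π, R, T) with |R| = r, |T| = k, R ⊆ T, π increasing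
-- on T and fixing R pointwise. For fixed R and T such a π is given by its image V = π(T), a k-set
-- (π restricted to T is then the increasing bijection T → V), and by an arbitrary bijection between
-- the complements, in (n - k)! ways. It fixes i ∈ T exactly when i ∈ V and i has the same rank in T
-- as in V. Hence n! E = (n - k)! Q(n,k,r), where Q counts such aligned triples (R, T, V).
-- Cutting at the least element p of R, before which T and V must have equally many elements j,
-- gives Q(m,k,r+1) = Σ_{p<m} Σ_{j<k} C(p,j)² Q(m-1-p, k-1-j, r) and Q(m,k,0) = C(m,k)².
-- The composition sum satisfies the same recursion (p and j playing n₁ and k₁), so it equals Q,
-- and E = (n - k)! Q / n! = Q / P(n,k).

module Submission where

open import Data.Bool using (Bool; true; false; _∧_; _∨_; not) renaming (T to IsTrue)
open import Data.Bool.Properties using (∧-identityʳ; ∧-zeroʳ; ∧-conicalˡ; ∧-conicalʳ; ∨-zeroʳ; not-injective; T-∧; T-≡; T?)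
open import Data.Empty using (⊥-elim)
open import Data.Fin using (Fin; zero; suc) renaming (_<_ to _<ᶠ_)
open import Data.Fin.Properties using (all?)
  renaming (_≟_ to _≟ᶠ_; _<?_ to _<ᶠ?_; 0≢1+n to 0≢1+nᶠ; <-irrefl to <ᶠ-irrefl; <-asym to <ᶠ-asym; suc-injective to suc-injectiveᶠ)
open import Data.Fin.Subset using (Subset; _∈_; _⊆_; ∣_∣; ⊥)
open import Data.Fin.Subset.Properties using (_∈?_; ∣p∣≤n; ∣⊥∣≡0)
open import Data.List using (List; []; _∷_; _++_; _∷ʳ_; map; concatMap; filter; length; upTo; allFin; cartesianProduct)
import Data.List as List
open import Data.List.Membership.Propositional using () renaming (_∈_ to _∈ₗ_)
open import Data.List.Membership.Propositional.Properties using (∈-upTo⁻)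
open import Data.List.Properties using (map-++; map-applyUpTo; map-upTo; map-tabulate; length-++; ++-assoc)
open import Data.List.Relation.Unary.All as All using (All; []; _∷_)
open import Data.List.Relation.Unary.All.Properties using (tabulate⁺)
open import Data.List.Relation.Unary.AllPairs using (AllPairs; []; _∷_; allPairs?)
import Data.List.Relation.Unary.Any as Any
open import Data.Maybe using (Maybe; just; nothing)
open import Data.Maybe.Properties using (just-injective) renaming (≡-dec to ≡-dec-Maybe)
open import Data.Nat using (ℕ; zero; suc; _+_; _*_; _∸_; _^_; _≤_; _<_; _≟_; _<?_; _≤?_; _≤ᵇ_; _!; NonZero; z≤n; s≤s; z<s)
open import Data.Nat.Combinatorics using (_C_; nCk+nC[k+1]≡[n+1]C[k+1])
open import Data.Nat.Combinatorics.Base using (_P′_)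
open import Data.Nat.Combinatorics.Specification using (nP′n≡n!)
open import Data.Nat.ListAction using (sum)
open import Data.Nat.ListAction.Properties using (sum-++)
open import Data.Nat.Properties
open import Data.Product using (_×_; _,_; ∃; proj₁; proj₂)
open import Data.Unit using (tt)
open import Data.Vec using (Vec; []; _∷_; toList; lookup; tabulate; here; there) renaming (allFin to allFinᵛ)
open import Data.Vec.Properties using (length-toList; lookup-allFin)
open import Defs
open import Function using (id; _∘_; case_of_; Equivalence)
open import Relation.Binary.PropositionalEquality
open import Relation.Nullary using (Dec; yes; no; does; ¬_; contradiction)
open import Relation.Nullary.Decidable using (_×-dec_; _→-dec_; dec-true)

open import Algebra.Properties.CommutativeSemigroup +-commutativeSemigroup using () renaming (interchange to +-interchange)
open import Algebra.Properties.CommutativeSemigroup *-commutativeSemigroup using () renaming (x∙yz≈y∙xz to x*[y*z]≡y*[x*z])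

-- Finite sums

∑ : {A : Set} → List A → (A → ℕ) → ℕ
∑ xs f = sum (map f xs)

syntax ∑ xs (λ x → e) = ∑[ x ← xs ] e

𝟙 : Bool → ℕ
𝟙 true  = 1
𝟙 false = 0

⟦_⟧ : {P : Set} → Dec P → ℕ
⟦ d ⟧ = 𝟙 (does d)

𝟙-∧ : ∀ b c → 𝟙 (b ∧ c) ≡ 𝟙 b * 𝟙 c
𝟙-∧ true  c = sym (+-identityʳ (𝟙 c))
𝟙-∧ false c = refl

does-cong : {P Q : Set} → (P → Q) → (Q → P) → (p : Dec P) (q : Dec Q) → does p ≡ does q
does-cong f g (yes _) (yes _) = refl
does-cong f g (yes p) (no ¬q) = ⊥-elim (¬q (f p))
does-cong f g (no ¬p) (yes q) = ⊥-elim (¬p (g q))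
does-cong f g (no _)  (no _)  = refl

⟦⟧-cong : {P Q : Set} → (P → Q) → (Q → P) → (p : Dec P) (q : Dec Q) → ⟦ p ⟧ ≡ ⟦ q ⟧
⟦⟧-cong f g p q = cong 𝟙 (does-cong f g p q)

⟦×-dec⟧ : {P Q : Set} (p : Dec P) (q : Dec Q) → ⟦ p ×-dec q ⟧ ≡ ⟦ p ⟧ * ⟦ q ⟧
⟦×-dec⟧ p q = 𝟙-∧ (does p) (does q)

does-true : {P : Set} (d : Dec P) → does d ≡ true → P
does-true (yes p) _ = p

⟦yes⟧ : {P : Set} (d : Dec P) → P → ⟦ d ⟧ ≡ 1
⟦yes⟧ (yes _) _ = refl
⟦yes⟧ (no ¬p) p = ⊥-elim (¬p p)

⟦no⟧ : {P : Set} (d : Dec P) → ¬ P → ⟦ d ⟧ ≡ 0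
⟦no⟧ (yes p) ¬p = ⊥-elim (¬p p)
⟦no⟧ (no _)  _  = refl

⟦⟧-*-cong : {P : Set} (d : Dec P) {x y : ℕ} → (P → x ≡ y) → ⟦ d ⟧ * x ≡ ⟦ d ⟧ * y
⟦⟧-*-cong (yes p) x≡y = cong (1 *_) (x≡y p)
⟦⟧-*-cong (no _)  _   = refl

module _ {A : Set} where

  ∑-++ : ∀ (xs ys : List A) (f : A → ℕ) → ∑ (xs ++ ys) f ≡ ∑ xs f + ∑ ys f
  ∑-++ xs ys f = trans (cong sum (map-++ f xs ys)) (sum-++ (map f xs) (map f ys))

  ∑-cong : ∀ (xs : List A) {f g : A → ℕ} → (∀ x → f x ≡ g x) → ∑ xs f ≡ ∑ xs g
  ∑-cong []       f≗g = refl
  ∑-cong (x ∷ xs) f≗g = cong₂ _+_ (f≗g x) (∑-cong xs f≗g)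

  ∑-cong-∈ : ∀ (xs : List A) {f g : A → ℕ} → (∀ {x} → x ∈ₗ xs → f x ≡ g x) → ∑ xs f ≡ ∑ xs g
  ∑-cong-∈ []       f≗g = refl
  ∑-cong-∈ (x ∷ xs) f≗g = cong₂ _+_ (f≗g (Any.here refl)) (∑-cong-∈ xs (f≗g ∘ Any.there))

  ∑-zero : ∀ (xs : List A) {f : A → ℕ} → (∀ x → f x ≡ 0) → ∑ xs f ≡ 0
  ∑-zero []       f≗0 = refl
  ∑-zero (x ∷ xs) f≗0 = cong₂ _+_ (f≗0 x) (∑-zero xs f≗0)

  ∑-zero-∈ : ∀ (xs : List A) {f : A → ℕ} → (∀ {x} → x ∈ₗ xs → f x ≡ 0) → ∑ xs f ≡ 0
  ∑-zero-∈ xs f≗0 = trans (∑-cong-∈ xs f≗0) (∑-zero xs λ _ → refl)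

  ∑-+ : ∀ (xs : List A) (f g : A → ℕ) → ∑[ x ← xs ] (f x + g x) ≡ ∑ xs f + ∑ xs g
  ∑-+ []       f g = refl
  ∑-+ (x ∷ xs) f g = trans (cong (f x + g x +_) (∑-+ xs f g)) (+-interchange (f x) (g x) _ _)

  ∑-*ˡ : ∀ (xs : List A) c (f : A → ℕ) → ∑[ x ← xs ] (c * f x) ≡ c * ∑ xs f
  ∑-*ˡ []       c f = sym (*-zeroʳ c)
  ∑-*ˡ (x ∷ xs) c f = trans (cong (c * f x +_) (∑-*ˡ xs c f)) (sym (*-distribˡ-+ c (f x) _))

  ∑-*ʳ : ∀ (xs : List A) c (f : A → ℕ) → ∑[ x ← xs ] (f x * c) ≡ ∑ xs f * c
  ∑-*ʳ xs c f = trans (∑-cong xs (λ x → *-comm (f x) c)) (trans (∑-*ˡ xs c f) (*-comm c _))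

  ∑-filter : {P : A → Set} (P? : ∀ x → Dec (P x)) (xs : List A) (f : A → ℕ) →
             ∑ (filter P? xs) f ≡ ∑[ x ← xs ] (⟦ P? x ⟧ * f x)
  ∑-filter P? []       f = refl
  ∑-filter P? (x ∷ xs) f with does (P? x)
  ... | false = ∑-filter P? xs f
  ... | true  = cong₂ _+_ (sym (+-identityʳ (f x))) (∑-filter P? xs f)

  length-filter : {P : A → Set} (P? : ∀ x → Dec (P x)) (xs : List A) →
                  length (filter P? xs) ≡ ∑[ x ← xs ] ⟦ P? x ⟧
  length-filter P? []       = refl
  length-filter P? (x ∷ xs) with does (P? x)
  ... | false = length-filter P? xs
  ... | true  = cong suc (length-filter P? xs)

∑-map : ∀ {A B : Set} (g : A → B) (xs : List A) (f : B → ℕ) → ∑ (map g xs) f ≡ ∑ xs (f ∘ g)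
∑-map g []       f = refl
∑-map g (x ∷ xs) f = cong (f (g x) +_) (∑-map g xs f)

∑-concatMap : ∀ {A B : Set} (g : A → List B) (xs : List A) (f : B → ℕ) → ∑ (concatMap g xs) f ≡ ∑[ x ← xs ] ∑ (g x) f
∑-concatMap g []       f = refl
∑-concatMap g (x ∷ xs) f = trans (∑-++ (g x) (concatMap g xs) f) (cong (∑ (g x) f +_) (∑-concatMap g xs f))

∑-comm : ∀ {A B : Set} (xs : List A) (ys : List B) (f : A → B → ℕ) →
         ∑[ x ← xs ] ∑[ y ← ys ] f x y ≡ ∑[ y ← ys ] ∑[ x ← xs ] f x y
∑-comm []       ys f = sym (∑-zero ys λ _ → refl)
∑-comm (x ∷ xs) ys f = trans (cong (∑ ys (f x) +_) (∑-comm xs ys f)) (sym (∑-+ ys (f x) _))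

∑∑-*ˡ : ∀ {A B : Set} (xs : List A) (ys : List B) c (f : A → B → ℕ) →
         ∑[ x ← xs ] ∑[ y ← ys ] (c * f x y) ≡ c * ∑[ x ← xs ] ∑[ y ← ys ] f x y
∑∑-*ˡ xs ys c f = trans (∑-cong xs (λ x → ∑-*ˡ ys c (f x))) (∑-*ˡ xs c _)

∑-cartesianProduct : ∀ {A B : Set} (xs : List A) (ys : List B) (f : A × B → ℕ) →
                     ∑ (cartesianProduct xs ys) f ≡ ∑[ x ← xs ] ∑[ y ← ys ] f (x , y)
∑-cartesianProduct []       ys f = refl
∑-cartesianProduct (x ∷ xs) ys f =
  trans (∑-++ (map (x ,_) ys) _ f) (cong₂ _+_ (∑-map (x ,_) ys f) (∑-cartesianProduct xs ys f))

∑-upTo-suc : ∀ n (f : ℕ → ℕ) → ∑ (upTo (suc n)) f ≡ f 0 + ∑ (upTo n) (f ∘ suc)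
∑-upTo-suc n f = cong (λ xs → f 0 + sum xs) (trans (map-applyUpTo suc f n) (sym (map-upTo (f ∘ suc) n)))

∑-upTo-≤ : ∀ {m n} (f : ℕ → ℕ) → m ≤ n → (∀ {i} → m ≤ i → i < n → f i ≡ 0) → ∑ (upTo n) f ≡ ∑ (upTo m) f
∑-upTo-≤ {n = n} f z≤n f≗0 = ∑-zero-∈ (upTo n) (λ i∈ → f≗0 z≤n (∈-upTo⁻ i∈))
∑-upTo-≤ {suc m} {suc n} f (s≤s m≤n) f≗0 = begin
  ∑ (upTo (suc n)) f           ≡⟨ ∑-upTo-suc n f ⟩
  f 0 + ∑ (upTo n) (f ∘ suc)   ≡⟨ cong (f 0 +_) (∑-upTo-≤ (f ∘ suc) m≤n (λ m≤i i<n → f≗0 (s≤s m≤i) (s≤s i<n))) ⟩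
  f 0 + ∑ (upTo m) (f ∘ suc)   ≡⟨ ∑-upTo-suc m f ⟨
  ∑ (upTo (suc m)) f           ∎
  where open ≡-Reasoning

∑-upTo-δ : ∀ n c (f : ℕ → ℕ) → ∑[ j ← upTo n ] (⟦ c ≟ j ⟧ * f j) ≡ ⟦ c <? n ⟧ * f c
∑-upTo-δ zero    c       f = refl
∑-upTo-δ (suc n) zero    f =
  trans (∑-upTo-suc n (λ j → ⟦ 0 ≟ j ⟧ * f j)) (trans (cong (_ +_) (∑-zero (upTo n) λ _ → refl)) (+-identityʳ _))
∑-upTo-δ (suc n) (suc c) f = begin
  ∑[ j ← upTo (suc n) ] (⟦ suc c ≟ j ⟧ * f j)     ≡⟨ ∑-upTo-suc n (λ j → ⟦ suc c ≟ j ⟧ * f j) ⟩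
  ∑[ j ← upTo n ] (⟦ suc c ≟ suc j ⟧ * f (suc j))
    ≡⟨ ∑-cong (upTo n) (λ j → cong (_* f (suc j)) (⟦⟧-cong suc-injective (cong suc) (suc c ≟ suc j) (c ≟ j))) ⟩
  ∑[ j ← upTo n ] (⟦ c ≟ j ⟧ * f (suc j))         ≡⟨ ∑-upTo-δ n c (f ∘ suc) ⟩
  ⟦ c <? n ⟧ * f (suc c)                          ≡⟨ cong (_* f (suc c)) (⟦⟧-cong s≤s ≤-pred (c <? n) (suc c <? suc n)) ⟩
  ⟦ suc c <? suc n ⟧ * f (suc c)                  ∎
  where open ≡-Reasoning

∑-allVecs-suc : ∀ {A : Set} (xs : List A) m (f : Vec A (suc m) → ℕ) →
                ∑ (allVecs xs (suc m)) f ≡ ∑[ x ← xs ] ∑[ v ← allVecs xs m ] f (x ∷ v)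
∑-allVecs-suc xs m f = trans (∑-concatMap (λ x → map (x ∷_) (allVecs xs m)) xs f)
                             (∑-cong xs (λ x → ∑-map (x ∷_) (allVecs xs m) f))

∑-allSubsets-suc : ∀ m (f : Subset (suc m) → ℕ) →
  ∑ (allSubsets (suc m)) f ≡ ∑[ V ← allSubsets m ] f (false ∷ V) + ∑[ V ← allSubsets m ] f (true ∷ V)
∑-allSubsets-suc m f = trans (∑-allVecs-suc (false ∷ true ∷ []) m f)
                             (cong (∑[ V ← allSubsets m ] f (false ∷ V) +_) (+-identityʳ (∑[ V ← allSubsets m ] f (true ∷ V))))

∑-allSubsets-empty : ∀ m (f : Subset m → ℕ) → ∑[ V ← allSubsets m ] (⟦ ∣ V ∣ ≟ 0 ⟧ * f V) ≡ f ⊥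
∑-allSubsets-empty zero    f = trans (+-identityʳ _) (*-identityˡ _)
∑-allSubsets-empty (suc m) f = begin
  ∑[ V ← allSubsets (suc m) ] (⟦ ∣ V ∣ ≟ 0 ⟧ * f V)
    ≡⟨ ∑-allSubsets-suc m (λ V → ⟦ ∣ V ∣ ≟ 0 ⟧ * f V) ⟩
  ∑[ V ← allSubsets m ] (⟦ ∣ V ∣ ≟ 0 ⟧ * f (false ∷ V)) + ∑[ V ← allSubsets m ] 0
    ≡⟨ cong₂ _+_ (∑-allSubsets-empty m (f ∘ (false ∷_))) (∑-zero (allSubsets m) (λ _ → refl)) ⟩
  f ⊥ + 0
    ≡⟨ +-identityʳ _ ⟩
  f ⊥ ∎
  where open ≡-Reasoning

∑-allSubsets-count : ∀ p c → ∑[ V ← allSubsets p ] ⟦ ∣ V ∣ ≟ c ⟧ ≡ p C c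
∑-allSubsets-count zero    zero    = refl
∑-allSubsets-count zero    (suc c) = refl
∑-allSubsets-count (suc p) zero    =
  trans (∑-allSubsets-suc p (λ V → ⟦ ∣ V ∣ ≟ 0 ⟧))
        (trans (cong₂ _+_ (∑-allSubsets-count p 0) (∑-zero (allSubsets p) (λ _ → refl))) (+-identityʳ 1))
∑-allSubsets-count (suc p) (suc c) =
  trans (∑-allSubsets-suc p (λ V → ⟦ ∣ V ∣ ≟ suc c ⟧))
        (trans (cong₂ _+_ (∑-allSubsets-count p (suc c)) (∑-allSubsets-count p c))
               (trans (+-comm (p C suc c) (p C c)) (nCk+nC[k+1]≡[n+1]C[k+1] p c)))

∑-allSubsets-card : ∀ p k (f : ℕ → ℕ) →
                    ∑[ V ← allSubsets p ] (⟦ ∣ V ∣ <? k ⟧ * f ∣ V ∣) ≡ ∑[ j ← upTo k ] ((p C j) * f j)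
∑-allSubsets-card p k f = begin
  ∑[ V ← allSubsets p ] (⟦ ∣ V ∣ <? k ⟧ * f ∣ V ∣)           ≡⟨ ∑-cong (allSubsets p) (λ V → ∑-upTo-δ k ∣ V ∣ f) ⟨
  ∑[ V ← allSubsets p ] ∑[ j ← upTo k ] (⟦ ∣ V ∣ ≟ j ⟧ * f j) ≡⟨ ∑-comm (allSubsets p) (upTo k) _ ⟩
  ∑[ j ← upTo k ] ∑[ V ← allSubsets p ] (⟦ ∣ V ∣ ≟ j ⟧ * f j) ≡⟨ ∑-cong (upTo k) (λ j → ∑-*ʳ (allSubsets p) (f j) _) ⟩
  ∑[ j ← upTo k ] (∑[ V ← allSubsets p ] ⟦ ∣ V ∣ ≟ j ⟧ * f j) ≡⟨ ∑-cong (upTo k) (λ j → cong (_* f j) (∑-allSubsets-count p j)) ⟩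
  ∑[ j ← upTo k ] ((p C j) * f j)                             ∎
  where open ≡-Reasoning

-- Words with distinct letters

_==_ : ∀ {N} → Fin N → Fin N → Bool
x == y = does (x ≟ᶠ y)

_∈ᵇ_ : ∀ {N} → Fin N → List (Fin N) → Bool
x ∈ᵇ []      = false
x ∈ᵇ (y ∷ L) = (x == y) ∨ (x ∈ᵇ L)

uniqueᵇ : ∀ {N} → List (Fin N) → Bool
uniqueᵇ []      = true
uniqueᵇ (x ∷ L) = not (x ∈ᵇ L) ∧ uniqueᵇ L

==-sym : ∀ {N} (x y : Fin N) → (x == y) ≡ (y == x)
==-sym x y = does-cong sym sym (x ≟ᶠ y) (y ≟ᶠ x)

∑-allFin-suc : ∀ {N} (f : Fin (suc N) → ℕ) → ∑ (allFin (suc N)) f ≡ f zero + ∑ (allFin N) (f ∘ suc)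
∑-allFin-suc f = cong (λ xs → f zero + sum xs) (trans (map-tabulate suc f) (sym (map-tabulate id (f ∘ suc))))

∑-allFin-1 : ∀ N → ∑[ x ← allFin N ] 1 ≡ N
∑-allFin-1 zero    = refl
∑-allFin-1 (suc N) = trans (∑-allFin-suc {N} (λ _ → 1)) (cong suc (∑-allFin-1 N))

∑-== : ∀ {N} (y : Fin N) → ∑[ x ← allFin N ] 𝟙 (x == y) ≡ 1
∑-== {suc N} zero    = trans (∑-allFin-suc {N} (λ x → 𝟙 (x == zero))) (cong suc (∑-zero (allFin N) λ _ → refl))
∑-== {suc N} (suc y) = trans (∑-allFin-suc {N} (λ x → 𝟙 (x == suc y))) (∑-== y)

uniqueᵇ-head : ∀ {N} {x : Fin N} {L} → uniqueᵇ (x ∷ L) ≡ true → (x ∈ᵇ L) ≢ true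
uniqueᵇ-head u x∈L = case trans (sym x∈L) (not-injective (∧-conicalˡ _ _ u)) of λ ()

∑-∈ᵇ : ∀ {N} (L : List (Fin N)) → uniqueᵇ L ≡ true → ∑[ x ← allFin N ] 𝟙 (x ∈ᵇ L) ≡ length L
∑-∈ᵇ {N} []      _  = ∑-zero (allFin N) λ _ → refl
∑-∈ᵇ {N} (y ∷ L) uL = begin
  ∑[ x ← allFin N ] 𝟙 ((x == y) ∨ (x ∈ᵇ L))
    ≡⟨ ∑-cong (allFin N) (λ x → 𝟙-∨-disjoint (x == y) (x ∈ᵇ L) (y∉L x)) ⟩
  ∑[ x ← allFin N ] (𝟙 (x == y) + 𝟙 (x ∈ᵇ L))
    ≡⟨ ∑-+ (allFin N) (λ x → 𝟙 (x == y)) (λ x → 𝟙 (x ∈ᵇ L)) ⟩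
  ∑[ x ← allFin N ] 𝟙 (x == y) + ∑[ x ← allFin N ] 𝟙 (x ∈ᵇ L)
    ≡⟨ cong₂ _+_ (∑-== y) (∑-∈ᵇ L (∧-conicalʳ _ _ uL)) ⟩
  suc (length L)
    ∎
  where
  open ≡-Reasoning
  𝟙-∨-disjoint : ∀ a b → (a ≡ true → b ≡ false) → 𝟙 (a ∨ b) ≡ 𝟙 a + 𝟙 b
  𝟙-∨-disjoint true  b a⇒¬b = cong (λ c → suc (𝟙 c)) (sym (a⇒¬b refl))
  𝟙-∨-disjoint false b _    = refl
  y∉L : ∀ x → (x == y) ≡ true → (x ∈ᵇ L) ≡ false
  y∉L x x==y rewrite does-true (x ≟ᶠ y) x==y = not-injective (∧-conicalˡ _ _ uL)

∑-∉ᵇ : ∀ {N} (L : List (Fin N)) → uniqueᵇ L ≡ true → ∑[ x ← allFin N ] 𝟙 (not (x ∈ᵇ L)) ≡ N ∸ length L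
∑-∉ᵇ {N} L uL = trans (sym (m+n∸n≡m A (length L))) (cong (_∸ length L) A+∣L∣≡N)
  where
  open ≡-Reasoning
  A = ∑[ x ← allFin N ] 𝟙 (not (x ∈ᵇ L))
  𝟙-not+𝟙 : ∀ b → 𝟙 (not b) + 𝟙 b ≡ 1
  𝟙-not+𝟙 true  = refl
  𝟙-not+𝟙 false = refl
  A+∣L∣≡N : A + length L ≡ N
  A+∣L∣≡N = begin
    A + length L                                         ≡⟨ cong (A +_) (∑-∈ᵇ L uL) ⟨
    A + ∑[ x ← allFin N ] 𝟙 (x ∈ᵇ L)                     ≡⟨ ∑-+ (allFin N) _ _ ⟨
    ∑[ x ← allFin N ] (𝟙 (not (x ∈ᵇ L)) + 𝟙 (x ∈ᵇ L))    ≡⟨ ∑-cong (allFin N) (λ x → 𝟙-not+𝟙 (x ∈ᵇ L)) ⟩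
    ∑[ x ← allFin N ] 1                                  ≡⟨ ∑-allFin-1 N ⟩
    N                                                    ∎

∈ᵇ-++-∷ : ∀ {N} (y x : Fin N) F L → y ∈ᵇ (F ++ x ∷ L) ≡ (y == x) ∨ (y ∈ᵇ (F ++ L))
∈ᵇ-++-∷ y x []      L = refl
∈ᵇ-++-∷ y x (z ∷ F) L = trans (cong ((y == z) ∨_) (∈ᵇ-++-∷ y x F L)) (∨-swap (y == z) (y == x) _)
  where
  ∨-swap : ∀ a b c → a ∨ (b ∨ c) ≡ b ∨ (a ∨ c)
  ∨-swap true  true  c = refl
  ∨-swap true  false c = refl
  ∨-swap false b     c = refl

uniqueᵇ-++-∷ : ∀ {N} (x : Fin N) F L → uniqueᵇ (F ++ x ∷ L) ≡ not (x ∈ᵇ (F ++ L)) ∧ uniqueᵇ (F ++ L)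
uniqueᵇ-++-∷ x []      L = refl
uniqueᵇ-++-∷ x (y ∷ F) L = begin
  not (y ∈ᵇ (F ++ x ∷ L)) ∧ uniqueᵇ (F ++ x ∷ L)
    ≡⟨ cong₂ (λ b u → not b ∧ u) (∈ᵇ-++-∷ y x F L) (uniqueᵇ-++-∷ x F L) ⟩
  not ((y == x) ∨ (y ∈ᵇ (F ++ L))) ∧ (not (x ∈ᵇ (F ++ L)) ∧ uniqueᵇ (F ++ L))
    ≡⟨ cong (λ b → not (b ∨ _) ∧ _) (==-sym y x) ⟩
  not ((x == y) ∨ (y ∈ᵇ (F ++ L))) ∧ (not (x ∈ᵇ (F ++ L)) ∧ uniqueᵇ (F ++ L))
    ≡⟨ exchange (x == y) _ _ _ ⟩
  not ((x == y) ∨ (x ∈ᵇ (F ++ L))) ∧ (not (y ∈ᵇ (F ++ L)) ∧ uniqueᵇ (F ++ L))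
    ∎
  where
  open ≡-Reasoning
  exchange : ∀ a b c d → not (a ∨ b) ∧ (not c ∧ d) ≡ not (a ∨ c) ∧ (not b ∧ d)
  exchange true  b     c     d = refl
  exchange false true  true  d = refl
  exchange false true  false d = refl
  exchange false false c     d = refl

∑-fresh : ∀ {N} (F L : List (Fin N)) →
          ∑[ x ← allFin N ] 𝟙 (uniqueᵇ (F ++ x ∷ L)) ≡ (N ∸ length (F ++ L)) * 𝟙 (uniqueᵇ (F ++ L))
∑-fresh {N} F L = trans (∑-cong (allFin N) (λ x → cong 𝟙 (uniqueᵇ-++-∷ x F L))) (by-uniqueness (uniqueᵇ (F ++ L)) refl)
  where
  by-uniqueness : ∀ u → uniqueᵇ (F ++ L) ≡ u → ∑[ x ← allFin N ] 𝟙 (not (x ∈ᵇ (F ++ L)) ∧ u) ≡ (N ∸ length (F ++ L)) * 𝟙 u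
  by-uniqueness false _  = trans (∑-zero (allFin N) (λ x → cong 𝟙 (∧-zeroʳ _))) (sym (*-zeroʳ (N ∸ length (F ++ L))))
  by-uniqueness true  uL = trans (∑-cong (allFin N) (λ x → cong 𝟙 (∧-identityʳ _)))
                                 (trans (∑-∉ᵇ (F ++ L) uL) (sym (*-identityʳ _)))

restrict : ∀ {A : Set} {m} → Subset m → Vec A m → List A
restrict []          []      = []
restrict (true  ∷ T) (x ∷ v) = x ∷ restrict T v
restrict (false ∷ T) (x ∷ v) = restrict T v

P′-∸-suc : ∀ a {c m} → c ≤ m → (a ∸ c) P′ (suc m ∸ c) ≡ (a ∸ m) * ((a ∸ c) P′ (m ∸ c))
P′-∸-suc a {c} {m} c≤m = begin
  (a ∸ c) P′ (suc m ∸ c)                    ≡⟨ cong ((a ∸ c) P′_) (+-∸-assoc 1 c≤m) ⟩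
  (a ∸ c ∸ (m ∸ c)) * ((a ∸ c) P′ (m ∸ c))  ≡⟨ cong (_* ((a ∸ c) P′ (m ∸ c))) a∸c∸[m∸c]≡a∸m ⟩
  (a ∸ m) * ((a ∸ c) P′ (m ∸ c))            ∎
  where
  open ≡-Reasoning
  a∸c∸[m∸c]≡a∸m : a ∸ c ∸ (m ∸ c) ≡ a ∸ m
  a∸c∸[m∸c]≡a∸m = trans (∸-+-assoc a c (m ∸ c)) (cong (a ∸_) (m+[n∸m]≡n c≤m))

module _ {N : ℕ} where

  words : ∀ m → List (Vec (Fin N) m)
  words = allVecs (allFin N)

  fresh : ∀ {m} → List (Fin N) → Vec (Fin N) m → ℕ
  fresh F v = 𝟙 (uniqueᵇ (F ++ toList v))

  fresh-∷ : ∀ {m} F x (v : Vec (Fin N) m) → fresh F (x ∷ v) ≡ fresh (F ∷ʳ x) v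
  fresh-∷ F x v = cong (𝟙 ∘ uniqueᵇ) (sym (++-assoc F (x ∷ []) (toList v)))

  ∑-fresh-∷ : ∀ {m} F (h : Vec (Fin N) m → ℕ) →
              ∑[ x ← allFin N ] ∑[ v ← words m ] (fresh F (x ∷ v) * h v) ≡ (N ∸ length F ∸ m) * ∑[ v ← words m ] (fresh F v * h v)
  ∑-fresh-∷ {m} F h = begin
    ∑[ x ← allFin N ] ∑[ v ← words m ] (fresh F (x ∷ v) * h v)
      ≡⟨ ∑-comm (allFin N) (words m) _ ⟩
    ∑[ v ← words m ] ∑[ x ← allFin N ] (fresh F (x ∷ v) * h v)
      ≡⟨ ∑-cong (words m) (λ v → ∑-*ʳ (allFin N) (h v) _) ⟩
    ∑[ v ← words m ] (∑[ x ← allFin N ] fresh F (x ∷ v) * h v)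
      ≡⟨ ∑-cong (words m) (λ v → cong (_* h v) (∑-fresh F (toList v))) ⟩
    ∑[ v ← words m ] ((N ∸ length (F ++ toList v)) * fresh F v * h v)
      ≡⟨ ∑-cong (words m) (λ v → trans (cong (λ l → l * fresh F v * h v) (N∸∣F++v∣ v)) (*-assoc (N ∸ length F ∸ m) _ _)) ⟩
    ∑[ v ← words m ] ((N ∸ length F ∸ m) * (fresh F v * h v))
      ≡⟨ ∑-*ˡ (words m) (N ∸ length F ∸ m) (λ v → fresh F v * h v) ⟩
    (N ∸ length F ∸ m) * ∑[ v ← words m ] (fresh F v * h v)
      ∎
    where
    open ≡-Reasoning
    N∸∣F++v∣ : (v : Vec (Fin N) m) → N ∸ length (F ++ toList v) ≡ N ∸ length F ∸ m
    N∸∣F++v∣ v = trans (cong (N ∸_) (trans (length-++ F) (cong (length F +_) (length-toList v))))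
                       (sym (∸-+-assoc N (length F) m))

  -- A word with distinct letters outside F is its restriction to T, with the same property, together
  -- with an injective filling of the remaining m - |T| positions by the letters not used yet.
  ∑-fresh-restrict : ∀ {m} (F : List (Fin N)) (T : Subset m) (g : List (Fin N) → ℕ) →
    ∑[ v ← words m ] (fresh F v * g (restrict T v))
    ≡ ((N ∸ length F ∸ ∣ T ∣) P′ (m ∸ ∣ T ∣)) * ∑[ w ← words ∣ T ∣ ] (fresh F w * g (toList w))
  ∑-fresh-restrict F []          g = sym (*-identityˡ (fresh F [] * g [] + 0))
  ∑-fresh-restrict {suc m} F (true ∷ T) g = begin
    ∑[ v ← words (suc m) ] (fresh F v * g (restrict (true ∷ T) v))
      ≡⟨ ∑-allVecs-suc (allFin N) m _ ⟩
    ∑[ x ← allFin N ] ∑[ v ← words m ] (fresh F (x ∷ v) * g (x ∷ restrict T v))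
      ≡⟨ ∑-cong (allFin N) (λ x → ∑-cong (words m) (λ v → cong (_* g (x ∷ restrict T v)) (fresh-∷ F x v))) ⟩
    ∑[ x ← allFin N ] ∑[ v ← words m ] (fresh (F ∷ʳ x) v * g (x ∷ restrict T v))
      ≡⟨ ∑-cong (allFin N) (λ x → ∑-fresh-restrict (F ∷ʳ x) T (g ∘ (x ∷_))) ⟩
    ∑[ x ← allFin N ] (((N ∸ length (F ∷ʳ x) ∸ c) P′ (m ∸ c)) * ∑[ w ← words c ] (fresh (F ∷ʳ x) w * g (x ∷ toList w)))
      ≡⟨ ∑-cong (allFin N) (λ x → cong₂ (λ a s → (a P′ (m ∸ c)) * s) (N∸∣F∷ʳx∣∸c x)
                                        (∑-cong (words c) (λ w → cong (_* g (x ∷ toList w)) (sym (fresh-∷ F x w))))) ⟩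
    ∑[ x ← allFin N ] (K * ∑[ w ← words c ] (fresh F (x ∷ w) * g (x ∷ toList w)))
      ≡⟨ ∑-*ˡ (allFin N) K (λ x → ∑[ w ← words c ] (fresh F (x ∷ w) * g (x ∷ toList w))) ⟩
    K * ∑[ x ← allFin N ] ∑[ w ← words c ] (fresh F (x ∷ w) * g (x ∷ toList w))
      ≡⟨ cong (K *_) (∑-allVecs-suc (allFin N) c (λ w → fresh F w * g (toList w))) ⟨
    K * ∑[ w ← words (suc c) ] (fresh F w * g (toList w))
      ∎
    where
    open ≡-Reasoning
    c = ∣ T ∣
    K = (N ∸ length F ∸ suc c) P′ (m ∸ c)
    N∸∣F∷ʳx∣∸c : ∀ x → N ∸ length (F ∷ʳ x) ∸ c ≡ N ∸ length F ∸ suc c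
    N∸∣F∷ʳx∣∸c x = begin
      N ∸ length (F ∷ʳ x) ∸ c   ≡⟨ cong (λ l → N ∸ l ∸ c) (length-++ F) ⟩
      N ∸ (length F + 1) ∸ c    ≡⟨ ∸-+-assoc N (length F + 1) c ⟩
      N ∸ (length F + 1 + c)    ≡⟨ cong (N ∸_) (+-assoc (length F) 1 c) ⟩
      N ∸ (length F + suc c)    ≡⟨ ∸-+-assoc N (length F) (suc c) ⟨
      N ∸ length F ∸ suc c      ∎
  ∑-fresh-restrict {suc m} F (false ∷ T) g = begin
    ∑[ v ← words (suc m) ] (fresh F v * g (restrict (false ∷ T) v))
      ≡⟨ ∑-allVecs-suc (allFin N) m _ ⟩
    ∑[ x ← allFin N ] ∑[ v ← words m ] (fresh F (x ∷ v) * g (restrict T v))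
      ≡⟨ ∑-fresh-∷ F (g ∘ restrict T) ⟩
    (N ∸ length F ∸ m) * ∑[ v ← words m ] (fresh F v * g (restrict T v))
      ≡⟨ cong ((N ∸ length F ∸ m) *_) (∑-fresh-restrict F T g) ⟩
    (N ∸ length F ∸ m) * (((N ∸ length F ∸ c) P′ (m ∸ c)) * S)
      ≡⟨ *-assoc (N ∸ length F ∸ m) ((N ∸ length F ∸ c) P′ (m ∸ c)) S ⟨
    (N ∸ length F ∸ m) * ((N ∸ length F ∸ c) P′ (m ∸ c)) * S
      ≡⟨ cong (_* S) (P′-∸-suc (N ∸ length F) (∣p∣≤n T)) ⟨
    ((N ∸ length F ∸ c) P′ (suc m ∸ c)) * S
      ∎
    where
    open ≡-Reasoning
    c = ∣ T ∣
    S = ∑[ w ← words c ] (fresh F w * g (toList w))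

  AllDistinct : ∀ {m} → Vec (Fin N) m → Set
  AllDistinct {m} v = ∀ (i j : Fin m) → lookup v i ≡ lookup v j → i ≡ j

  ∈ᵇ-toList⁺ : ∀ {m} (v : Vec (Fin N) m) j {x} → lookup v j ≡ x → (x ∈ᵇ toList v) ≡ true
  ∈ᵇ-toList⁺ (y ∷ v) zero    y≡x rewrite dec-true (_ ≟ᶠ y) (sym y≡x) = refl
  ∈ᵇ-toList⁺ (y ∷ v) (suc j) vj≡x = trans (cong (_ ∨_) (∈ᵇ-toList⁺ v j vj≡x)) (∨-zeroʳ _)

  ∈ᵇ-toList⁻ : ∀ {m} (v : Vec (Fin N) m) x → (x ∈ᵇ toList v) ≡ true → ∃ λ j → lookup v j ≡ x
  ∈ᵇ-toList⁻ (y ∷ v) x x∈v with x ≟ᶠ y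
  ... | yes x≡y = zero , sym x≡y
  ... | no  _   with ∈ᵇ-toList⁻ v x x∈v
  ...   | j , vj≡x = suc j , vj≡x

  unique⇒distinct : ∀ {m} (v : Vec (Fin N) m) → uniqueᵇ (toList v) ≡ true → AllDistinct v
  unique⇒distinct (x ∷ v) u zero    zero    _ = refl
  unique⇒distinct (x ∷ v) u zero    (suc j) x≡vj = contradiction (∈ᵇ-toList⁺ v j (sym x≡vj)) (uniqueᵇ-head {x = x} {toList v} u)
  unique⇒distinct (x ∷ v) u (suc i) zero    vi≡x = contradiction (∈ᵇ-toList⁺ v i vi≡x) (uniqueᵇ-head {x = x} {toList v} u)
  unique⇒distinct (x ∷ v) u (suc i) (suc j) vi≡vj = cong suc (unique⇒distinct v (∧-conicalʳ _ _ u) i j vi≡vj)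

  distinct⇒unique : ∀ {m} (v : Vec (Fin N) m) → AllDistinct v → uniqueᵇ (toList v) ≡ true
  distinct⇒unique []      inj = refl
  distinct⇒unique (x ∷ v) inj with x ∈ᵇ toList v in x∈v
  ... | true  = let j , vj≡x = ∈ᵇ-toList⁻ v x x∈v in ⊥-elim (0≢1+nᶠ (inj zero (suc j) (sym vj≡x)))
  ... | false = distinct⇒unique v (λ i j vi≡vj → suc-injectiveᶠ (inj (suc i) (suc j) vi≡vj))

-- Sorted words

module _ {A : Set} where

  All-restrict⁺ : ∀ {P : A → Set} {m} (T : Subset m) (v : Vec A m) →
                  (∀ j → j ∈ T → P (lookup v j)) → All P (restrict T v)
  All-restrict⁺ []          []      _  = []
  All-restrict⁺ (true  ∷ T) (x ∷ v) Pv = Pv zero here ∷ All-restrict⁺ T v (λ j j∈T → Pv (suc j) (there j∈T))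
  All-restrict⁺ (false ∷ T) (x ∷ v) Pv = All-restrict⁺ T v (λ j j∈T → Pv (suc j) (there j∈T))

  All-restrict⁻ : ∀ {P : A → Set} {m} (T : Subset m) (v : Vec A m) →
                  All P (restrict T v) → ∀ j → j ∈ T → P (lookup v j)
  All-restrict⁻ (true  ∷ T) (x ∷ v) (px ∷ _)  zero    here         = px
  All-restrict⁻ (true  ∷ T) (x ∷ v) (_  ∷ Pv) (suc j) (there j∈T) = All-restrict⁻ T v Pv j j∈T
  All-restrict⁻ (false ∷ T) (x ∷ v) Pv        (suc j) (there j∈T) = All-restrict⁻ T v Pv j j∈T

module _ {N : ℕ} where

  Sorted : List (Fin N) → Set
  Sorted = AllPairs _<ᶠ_

  sorted? : (L : List (Fin N)) → Dec (Sorted L)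
  sorted? = allPairs? _<ᶠ?_

  IncreasingOn : ∀ {m} → Vec (Fin N) m → Subset m → Set
  IncreasingOn {m} π T = ∀ (i j : Fin m) → i ∈ T → j ∈ T → i <ᶠ j → lookup π i <ᶠ lookup π j

  increasing⇒sorted : ∀ {m} (π : Vec (Fin N) m) T → IncreasingOn π T → Sorted (restrict T π)
  increasing⇒sorted []      []          inc = []
  increasing⇒sorted (x ∷ π) (true  ∷ T) inc =
    All-restrict⁺ T π (λ j j∈T → inc zero (suc j) here (there j∈T) (s≤s z≤n))
    ∷ increasing⇒sorted π T (λ i j i∈T j∈T i<j → inc (suc i) (suc j) (there i∈T) (there j∈T) (s≤s i<j))
  increasing⇒sorted (x ∷ π) (false ∷ T) inc =
    increasing⇒sorted π T (λ i j i∈T j∈T i<j → inc (suc i) (suc j) (there i∈T) (there j∈T) (s≤s i<j))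

  sorted⇒increasing : ∀ {m} (π : Vec (Fin N) m) T → Sorted (restrict T π) → IncreasingOn π T
  sorted⇒increasing (x ∷ π) (true  ∷ T) (x<π ∷ _) zero    (suc j) here        (there j∈T) _ = All-restrict⁻ T π x<π j j∈T
  sorted⇒increasing (x ∷ π) (true  ∷ T) (_ ∷ π↑) (suc i) (suc j) (there i∈T) (there j∈T) (s≤s i<j) =
    sorted⇒increasing π T π↑ i j i∈T j∈T i<j
  sorted⇒increasing (x ∷ π) (false ∷ T) π↑       (suc i) (suc j) (there i∈T) (there j∈T) (s≤s i<j) =
    sorted⇒increasing π T π↑ i j i∈T j∈T i<j

  ∈ᵇ⇒∈ : ∀ (x : Fin N) L → x ∈ᵇ L ≡ true → x ∈ₗ L
  ∈ᵇ⇒∈ x (y ∷ L) x∈L with x ≟ᶠ y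
  ... | yes x≡y = Any.here x≡y
  ... | no  _   = Any.there (∈ᵇ⇒∈ x L x∈L)

  sorted⇒unique : ∀ {L : List (Fin N)} → Sorted L → uniqueᵇ L ≡ true
  sorted⇒unique {[]}    []          = refl
  sorted⇒unique {x ∷ L} (x<L ∷ L↑) with x ∈ᵇ L in x∈L
  ... | false = sorted⇒unique L↑
  ... | true  = ⊥-elim (<ᶠ-irrefl refl (All.lookup x<L (∈ᵇ⇒∈ x L x∈L)))

restrict-⊥ : ∀ {A : Set} {m} (v : Vec A m) → restrict ⊥ v ≡ []
restrict-⊥ []      = refl
restrict-⊥ (x ∷ v) = restrict-⊥ v

module _ {A : Set} where

  ∑-allVecs-cong : ∀ (ys : List A) c {f g : Vec A c → ℕ} →
                   (∀ w → All (_∈ₗ ys) (toList w) → f w ≡ g w) → ∑ (allVecs ys c) f ≡ ∑ (allVecs ys c) g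
  ∑-allVecs-cong ys zero    f≗g = cong (_+ 0) (f≗g [] [])
  ∑-allVecs-cong ys (suc c) {f} {g} f≗g = begin
    ∑ (allVecs ys (suc c)) f                   ≡⟨ ∑-allVecs-suc ys c f ⟩
    ∑[ y ← ys ] ∑[ w ← allVecs ys c ] f (y ∷ w)
      ≡⟨ ∑-cong-∈ ys (λ y∈ys → ∑-allVecs-cong ys c (λ w w∈ys → f≗g (_ ∷ w) (y∈ys ∷ w∈ys))) ⟩
    ∑[ y ← ys ] ∑[ w ← allVecs ys c ] g (y ∷ w) ≡⟨ ∑-allVecs-suc ys c g ⟨
    ∑ (allVecs ys (suc c)) g                   ∎
    where open ≡-Reasoning

  ∑-allVecs-drop : ∀ (x : A) ys c {f : Vec A c → ℕ} →
                   (∀ w → x ∈ₗ toList w → f w ≡ 0) → ∑ (allVecs (x ∷ ys) c) f ≡ ∑ (allVecs ys c) f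
  ∑-allVecs-drop x ys zero    f₀ = refl
  ∑-allVecs-drop x ys (suc c) {f} f₀ = begin
    ∑ (allVecs (x ∷ ys) (suc c)) f
      ≡⟨ ∑-allVecs-suc (x ∷ ys) c f ⟩
    ∑[ w ← allVecs (x ∷ ys) c ] f (x ∷ w) + ∑[ y ← ys ] ∑[ w ← allVecs (x ∷ ys) c ] f (y ∷ w)
      ≡⟨ cong₂ _+_ (∑-zero (allVecs (x ∷ ys) c) (λ w → f₀ (x ∷ w) (Any.here refl)))
                   (∑-cong ys (λ y → ∑-allVecs-drop x ys c (λ w x∈w → f₀ (y ∷ w) (Any.there x∈w)))) ⟩
    0 + ∑[ y ← ys ] ∑[ w ← allVecs ys c ] f (y ∷ w)
      ≡⟨ ∑-allVecs-suc ys c f ⟨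
    ∑ (allVecs ys (suc c)) f
      ∎
    where open ≡-Reasoning

module _ {N : ℕ} where

  ∑-sorted-words : ∀ {m} (xs : Vec (Fin N) m) → Sorted (toList xs) → ∀ c (h : List (Fin N) → ℕ) →
    ∑[ w ← allVecs (toList xs) c ] (⟦ sorted? (toList w) ⟧ * h (toList w))
    ≡ ∑[ V ← allSubsets m ] (⟦ ∣ V ∣ ≟ c ⟧ * h (restrict V xs))
  ∑-sorted-words []       _ zero    h = refl
  ∑-sorted-words []       _ (suc c) h = refl
  ∑-sorted-words (x ∷ xs) _ zero    h =
    trans (trans (+-identityʳ _) (*-identityˡ _))
          (sym (trans (∑-allSubsets-empty _ (λ V → h (restrict V (x ∷ xs)))) (cong h (restrict-⊥ xs))))
  ∑-sorted-words (x ∷ xs) (x<xs ∷ xs↑) (suc c) h = begin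
    ∑[ w ← allVecs (x ∷ ys) (suc c) ] (⟦ sorted? (toList w) ⟧ * h (toList w))
      ≡⟨ ∑-allVecs-suc (x ∷ ys) c _ ⟩
    ∑[ y ← x ∷ ys ] ∑[ w ← allVecs (x ∷ ys) c ] summand y w
      ≡⟨ ∑-cong-∈ (x ∷ ys) (λ y∈ → ∑-allVecs-drop x ys c (λ w x∈w → summand-vanishes y∈ w x∈w)) ⟩
    ∑[ w ← allVecs ys c ] summand x w + ∑[ y ← ys ] ∑[ w ← allVecs ys c ] summand y w
      ≡⟨ cong₂ _+_ (∑-allVecs-cong ys c (λ w w∈xs → cong (_* h (x ∷ toList w)) (sorted-∷ w w∈xs)))
                   (sym (∑-allVecs-suc ys c (λ w → ⟦ sorted? (toList w) ⟧ * h (toList w)))) ⟩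
    ∑[ w ← allVecs ys c ] (⟦ sorted? (toList w) ⟧ * h (x ∷ toList w)) + ∑[ w ← allVecs ys (suc c) ] (⟦ sorted? (toList w) ⟧ * h (toList w))
      ≡⟨ cong₂ _+_ (∑-sorted-words xs xs↑ c (h ∘ (x ∷_))) (∑-sorted-words xs xs↑ (suc c) h) ⟩
    ∑[ V ← allSubsets _ ] (⟦ ∣ V ∣ ≟ c ⟧ * h (x ∷ restrict V xs)) + ∑[ V ← allSubsets _ ] (⟦ ∣ V ∣ ≟ suc c ⟧ * h (restrict V xs))
      ≡⟨ +-comm (∑[ V ← allSubsets _ ] (⟦ ∣ V ∣ ≟ c ⟧ * h (x ∷ restrict V xs))) _ ⟩
    ∑[ V ← allSubsets _ ] (⟦ ∣ V ∣ ≟ suc c ⟧ * h (restrict V xs)) + ∑[ V ← allSubsets _ ] (⟦ ∣ V ∣ ≟ c ⟧ * h (x ∷ restrict V xs))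
      ≡⟨ ∑-allSubsets-suc _ (λ V → ⟦ ∣ V ∣ ≟ suc c ⟧ * h (restrict V (x ∷ xs))) ⟨
    ∑[ V ← allSubsets (suc _) ] (⟦ ∣ V ∣ ≟ suc c ⟧ * h (restrict V (x ∷ xs)))
      ∎
    where
    open ≡-Reasoning
    ys = toList xs
    summand : Fin N → Vec (Fin N) c → ℕ
    summand y w = ⟦ sorted? (y ∷ toList w) ⟧ * h (y ∷ toList w)
    summand-vanishes : ∀ {y} → y ∈ₗ x ∷ ys → ∀ w → x ∈ₗ toList w → summand y w ≡ 0
    summand-vanishes {y} y∈ w x∈w = cong (_* h (y ∷ toList w)) (⟦no⟧ (sorted? (y ∷ toList w)) λ { (y<w ∷ _) → y≮x y∈ (All.lookup y<w x∈w) })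
      where
      y≮x : ∀ {y} → y ∈ₗ x ∷ ys → ¬ (y <ᶠ x)
      y≮x (Any.here refl) = <ᶠ-irrefl refl
      y≮x (Any.there y∈) = <ᶠ-asym (All.lookup x<xs y∈)
    sorted-∷ : ∀ w → All (_∈ₗ ys) (toList w) → ⟦ sorted? (x ∷ toList w) ⟧ ≡ ⟦ sorted? (toList w) ⟧
    sorted-∷ w w∈xs = ⟦⟧-cong (λ { (_ ∷ w↑) → w↑ }) (All.map (All.lookup x<xs) w∈xs ∷_) (sorted? (x ∷ toList w)) (sorted? (toList w))

toList-tabulate : ∀ {A : Set} {n} (f : Fin n → A) → toList (tabulate f) ≡ List.tabulate f
toList-tabulate {n = zero}  f = refl
toList-tabulate {n = suc n} f = cong (f zero ∷_) (toList-tabulate (f ∘ suc))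

sorted-tabulate : ∀ {N n} (f : Fin n → Fin N) → (∀ {i j} → i <ᶠ j → f i <ᶠ f j) → Sorted (List.tabulate f)
sorted-tabulate {n = zero}  f mono = []
sorted-tabulate {n = suc n} f mono = tabulate⁺ (λ _ → mono (s≤s z≤n)) ∷ sorted-tabulate (f ∘ suc) (mono ∘ s≤s)

∑-sorted-allFin : ∀ {n} c (h : List (Fin n) → ℕ) →
  ∑[ w ← words c ] (⟦ sorted? (toList w) ⟧ * h (toList w))
  ≡ ∑[ V ← allSubsets n ] (⟦ ∣ V ∣ ≟ c ⟧ * h (restrict V (allFinᵛ n)))
∑-sorted-allFin {n} c h =
  trans (cong (λ ys → ∑[ w ← allVecs ys c ] (⟦ sorted? (toList w) ⟧ * h (toList w))) (sym (toList-tabulate id)))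
        (∑-sorted-words (allFinᵛ n) (subst Sorted (sym (toList-tabulate id)) (sorted-tabulate id id)) c h)

-- Aligned triples

_‼_ : ∀ {A : Set} → List A → ℕ → Maybe A
[]      ‼ j     = nothing
(x ∷ L) ‼ zero  = just x
(x ∷ L) ‼ suc j = L ‼ j

rank : ∀ {m} → Subset m → Fin m → ℕ
rank (b ∷ T) zero    = 0
rank (b ∷ T) (suc i) = 𝟙 b + rank T i

module _ {A : Set} where

  restrict-‼ : ∀ {m} (T : Subset m) (v : Vec A m) {i} → i ∈ T → restrict T v ‼ rank T i ≡ just (lookup v i)
  restrict-‼ (true  ∷ T) (x ∷ v) here        = refl
  restrict-‼ (true  ∷ T) (x ∷ v) (there i∈T) = restrict-‼ T v i∈T
  restrict-‼ (false ∷ T) (x ∷ v) (there i∈T) = restrict-‼ T v i∈T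

  restrict-‼⁻ : ∀ {m} (T : Subset m) (v : Vec A m) j {y} → restrict T v ‼ j ≡ just y →
                ∃ λ i → i ∈ T × rank T i ≡ j × lookup v i ≡ y
  restrict-‼⁻ []          []      j       ()
  restrict-‼⁻ (true  ∷ T) (x ∷ v) zero    x≡y = zero , here , refl , just-injective x≡y
  restrict-‼⁻ (true  ∷ T) (x ∷ v) (suc j) eq with restrict-‼⁻ T v j eq
  ... | i , i∈T , refl , vi≡y = suc i , there i∈T , refl , vi≡y
  restrict-‼⁻ (false ∷ T) (x ∷ v) j       eq with restrict-‼⁻ T v j eq
  ... | i , i∈T , refl , vi≡y = suc i , there i∈T , refl , vi≡y

Aligned : ∀ {m} → ℕ → ℕ → Subset m → Subset m → Subset m → Set
Aligned a b R T V = ∀ i → i ∈ R → i ∈ T × i ∈ V × a + rank T i ≡ b + rank V i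

module _ {m : ℕ} where

  FixedAlong : Subset m → Subset m → List (Fin m) → Set
  FixedAlong R T L = ∀ i → i ∈ R → i ∈ T × L ‼ rank T i ≡ just i

  fixedAlong? : ∀ R T L → Dec (FixedAlong R T L)
  fixedAlong? R T L = all? λ i → (i ∈? R) →-dec ((i ∈? T) ×-dec ≡-dec-Maybe _≟ᶠ_ (L ‼ rank T i) (just i))

  fixed⇒fixedAlong : ∀ (π : Vec (Fin m) m) R T → FixedSet π R → R ⊆ T → FixedAlong R T (restrict T π)
  fixed⇒fixedAlong π R T fix R⊆T i i∈R = R⊆T i∈R , trans (restrict-‼ T π (R⊆T i∈R)) (cong just (fix i i∈R))

  fixedAlong⇒fixed : ∀ (π : Vec (Fin m) m) R T → FixedAlong R T (restrict T π) → FixedSet π R × R ⊆ T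
  fixedAlong⇒fixed π R T fix =
    (λ i i∈R → let i∈T , πi≡i = fix i i∈R in just-injective (trans (sym (restrict-‼ T π i∈T)) πi≡i)) ,
    (λ {i} i∈R → proj₁ (fix i i∈R))

  fixedAlong⇒aligned : ∀ (R T V : Subset m) → FixedAlong R T (restrict V (allFinᵛ m)) → Aligned 0 0 R T V
  fixedAlong⇒aligned R T V fix i i∈R with fix i i∈R
  ... | i∈T , eq with restrict-‼⁻ V (allFinᵛ m) (rank T i) eq
  ...   | i′ , i′∈V , rankV≡rankT , i′≡i rewrite lookup-allFin i′ | i′≡i = i∈T , i′∈V , sym rankV≡rankT

  aligned⇒fixedAlong : ∀ (R T V : Subset m) → Aligned 0 0 R T V → FixedAlong R T (restrict V (allFinᵛ m))
  aligned⇒fixedAlong R T V al i i∈R with al i i∈R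
  ... | i∈T , i∈V , rankT≡rankV =
    i∈T , trans (cong (restrict V (allFinᵛ m) ‼_) rankT≡rankV) (trans (restrict-‼ V (allFinᵛ m) i∈V) (cong just (lookup-allFin i)))

-- a and b count the elements of T and of V passed so far.
alignedᵇ : ∀ {m} → ℕ → ℕ → Subset m → Subset m → Subset m → Bool
alignedᵇ a b []      []      []      = true
alignedᵇ a b (ρ ∷ R) (t ∷ T) (v ∷ V) = (not ρ ∨ (t ∧ v ∧ does (a ≟ b))) ∧ alignedᵇ (a + 𝟙 t) (b + 𝟙 v) R T V

alignedᵇ⇒Aligned : ∀ {m} a b (R T V : Subset m) → IsTrue (alignedᵇ a b R T V) → Aligned a b R T V
alignedᵇ⇒Aligned a b (true ∷ R) (true ∷ T) (true ∷ V) h zero here =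
  here , here , cong (_+ 0) (does-true (a ≟ b) (Equivalence.to T-≡ (proj₁ (Equivalence.to T-∧ h))))
alignedᵇ⇒Aligned a b (ρ ∷ R) (t ∷ T) (v ∷ V) h (suc i) (there i∈R)
  with alignedᵇ⇒Aligned (a + 𝟙 t) (b + 𝟙 v) R T V (proj₂ (Equivalence.to (T-∧ {not ρ ∨ (t ∧ v ∧ does (a ≟ b))}) h)) i i∈R
... | i∈T , i∈V , eq = there i∈T , there i∈V , trans (sym (+-assoc a (𝟙 t) _)) (trans eq (+-assoc b (𝟙 v) _))

Aligned⇒alignedᵇ : ∀ {m} a b (R T V : Subset m) → Aligned a b R T V → IsTrue (alignedᵇ a b R T V)
Aligned⇒alignedᵇ a b []      []      []      al = _
Aligned⇒alignedᵇ a b (ρ ∷ R) (t ∷ T) (v ∷ V) al =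
  Equivalence.from T-∧ (first ρ al , Aligned⇒alignedᵇ (a + 𝟙 t) (b + 𝟙 v) R T V rest)
  where
  first : ∀ ρ → Aligned a b (ρ ∷ R) (t ∷ T) (v ∷ V) → IsTrue (not ρ ∨ (t ∧ v ∧ does (a ≟ b)))
  first false _  = _
  first true  al with al zero here
  ... | here , here , eq = Equivalence.from T-≡ (dec-true (a ≟ b) (trans (sym (+-identityʳ a)) (trans eq (+-identityʳ b))))
  rest : Aligned (a + 𝟙 t) (b + 𝟙 v) R T V
  rest i i∈R with al (suc i) (there i∈R)
  ... | there i∈T , there i∈V , eq = i∈T , i∈V , trans (+-assoc a (𝟙 t) _) (trans eq (sym (+-assoc b (𝟙 v) _)))

weight : ∀ {m} → ℕ → ℕ → Subset m → Subset m → Subset m → ℕ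
weight k r R T V = ⟦ ∣ R ∣ ≟ r ⟧ * (⟦ ∣ T ∣ ≟ k ⟧ * (⟦ ∣ V ∣ ≟ k ⟧ * 𝟙 (alignedᵇ 0 0 R T V)))

alignedPairs : ∀ {m} → ℕ → ℕ → Subset m → ℕ
alignedPairs {m} k r R = ∑[ T ← allSubsets m ] ∑[ V ← allSubsets m ] weight k r R T V

alignedTriples : ℕ → ℕ → ℕ → ℕ
alignedTriples m k r = ∑[ R ← allSubsets m ] alignedPairs k r R

module _ {n : ℕ} where

  injective-indicator : ∀ (π : Vec (Fin n) n) → ⟦ injective? π ⟧ ≡ fresh [] π
  injective-indicator π = ⟦⟧-cong (Equivalence.from T-≡ ∘ distinct⇒unique π) (unique⇒distinct π ∘ Equivalence.to T-≡)
                                  (injective? π) (T? (uniqueᵇ (toList π)))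

  fresh-[]-sorted : ∀ {c} (w : Vec (Fin n) c) → fresh [] w * ⟦ sorted? (toList w) ⟧ ≡ ⟦ sorted? (toList w) ⟧
  fresh-[]-sorted w with sorted? (toList w)
  ... | yes w↑ rewrite sorted⇒unique w↑ = refl
  ... | no  _  = *-zeroʳ (fresh [] w)

  module _ (k r : ℕ) (R T : Subset n) where

    sortedFixedAlong : List (Fin n) → ℕ
    sortedFixedAlong L = ⟦ sorted? L ⟧ * ⟦ fixedAlong? R T L ⟧

    good-indicator : ∀ (π : Vec (Fin n) n) →
      ⟦ good? k r π (R , T) ⟧ ≡ ⟦ ∣ R ∣ ≟ r ⟧ * (⟦ ∣ T ∣ ≟ k ⟧ * sortedFixedAlong (restrict T π))
    good-indicator π = begin
      ⟦ good? k r π (R , T) ⟧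
        ≡⟨ ⟦⟧-cong to from (good? k r π (R , T)) ((∣ R ∣ ≟ r) ×-dec ((∣ T ∣ ≟ k) ×-dec (sorted? L ×-dec fixedAlong? R T L))) ⟩
      ⟦ (∣ R ∣ ≟ r) ×-dec ((∣ T ∣ ≟ k) ×-dec (sorted? L ×-dec fixedAlong? R T L)) ⟧
        ≡⟨ ⟦×-dec⟧ (∣ R ∣ ≟ r) ((∣ T ∣ ≟ k) ×-dec (sorted? L ×-dec fixedAlong? R T L)) ⟩
      ⟦ ∣ R ∣ ≟ r ⟧ * ⟦ (∣ T ∣ ≟ k) ×-dec (sorted? L ×-dec fixedAlong? R T L) ⟧
        ≡⟨ cong (⟦ ∣ R ∣ ≟ r ⟧ *_) (trans (⟦×-dec⟧ (∣ T ∣ ≟ k) (sorted? L ×-dec fixedAlong? R T L)) (cong (⟦ ∣ T ∣ ≟ k ⟧ *_) (⟦×-dec⟧ (sorted? L) (fixedAlong? R T L)))) ⟩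
      ⟦ ∣ R ∣ ≟ r ⟧ * (⟦ ∣ T ∣ ≟ k ⟧ * sortedFixedAlong L)
        ∎
      where
      open ≡-Reasoning
      L = restrict T π
      to : Good k r π (R , T) → ∣ R ∣ ≡ r × ∣ T ∣ ≡ k × Sorted L × FixedAlong R T L
      to (∣R∣≡r , fix , ∣T∣≡k , inc , R⊆T) = ∣R∣≡r , ∣T∣≡k , increasing⇒sorted π T inc , fixed⇒fixedAlong π R T fix R⊆T
      from : ∣ R ∣ ≡ r × ∣ T ∣ ≡ k × Sorted L × FixedAlong R T L → Good k r π (R , T)
      from (∣R∣≡r , ∣T∣≡k , L↑ , fixL) = let fix , R⊆T = fixedAlong⇒fixed π R T fixL in
        ∣R∣≡r , fix , ∣T∣≡k , sorted⇒increasing π T L↑ , R⊆T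

    ∑-sortedFixedAlong : ∀ c → ∑[ w ← words c ] (fresh [] w * sortedFixedAlong (toList w))
                             ≡ ∑[ V ← allSubsets n ] (⟦ ∣ V ∣ ≟ c ⟧ * 𝟙 (alignedᵇ 0 0 R T V))
    ∑-sortedFixedAlong c = begin
      ∑[ w ← words c ] (fresh [] w * (⟦ sorted? (toList w) ⟧ * ⟦ fixedAlong? R T (toList w) ⟧))
        ≡⟨ ∑-cong (words c) (λ w → trans (sym (*-assoc (fresh [] w) _ _)) (cong (_* ⟦ fixedAlong? R T (toList w) ⟧) (fresh-[]-sorted w))) ⟩
      ∑[ w ← words c ] (⟦ sorted? (toList w) ⟧ * ⟦ fixedAlong? R T (toList w) ⟧)
        ≡⟨ ∑-sorted-allFin c (λ L → ⟦ fixedAlong? R T L ⟧) ⟩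
      ∑[ V ← allSubsets n ] (⟦ ∣ V ∣ ≟ c ⟧ * ⟦ fixedAlong? R T (restrict V (allFinᵛ n)) ⟧)
        ≡⟨ ∑-cong (allSubsets n) (λ V → cong (⟦ ∣ V ∣ ≟ c ⟧ *_) (⟦⟧-cong
             (Aligned⇒alignedᵇ 0 0 R T V ∘ fixedAlong⇒aligned R T V) (aligned⇒fixedAlong R T V ∘ alignedᵇ⇒Aligned 0 0 R T V)
             (fixedAlong? R T (restrict V (allFinᵛ n))) (T? (alignedᵇ 0 0 R T V)))) ⟩
      ∑[ V ← allSubsets n ] (⟦ ∣ V ∣ ≟ c ⟧ * 𝟙 (alignedᵇ 0 0 R T V))
        ∎
      where open ≡-Reasoning

    ∑-injective-good : ∑[ π ← words n ] (⟦ injective? π ⟧ * ⟦ good? k r π (R , T) ⟧)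
                     ≡ (n ∸ k) ! * ∑[ V ← allSubsets n ] weight k r R T V
    ∑-injective-good = begin
      ∑[ π ← words n ] (⟦ injective? π ⟧ * ⟦ good? k r π (R , T) ⟧)
        ≡⟨ ∑-cong (words n) (λ π → trans (cong₂ _*_ (injective-indicator π) (good-indicator π))
                                         (trans (x*[y*z]≡y*[x*z] (fresh [] π) a _) (cong (a *_) (x*[y*z]≡y*[x*z] (fresh [] π) b _)))) ⟩
      ∑[ π ← words n ] (a * (b * (fresh [] π * sortedFixedAlong (restrict T π))))
        ≡⟨ trans (∑-*ˡ (words n) a _) (cong (a *_) (∑-*ˡ (words n) b _)) ⟩
      a * (b * ∑[ π ← words n ] (fresh [] π * sortedFixedAlong (restrict T π)))
        ≡⟨ cong (a *_) (⟦⟧-*-cong (∣ T ∣ ≟ k) ∣T∣≡k⇒) ⟩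
      a * (b * ((n ∸ k) ! * W))
        ≡⟨ trans (cong (a *_) (x*[y*z]≡y*[x*z] b ((n ∸ k) !) W)) (x*[y*z]≡y*[x*z] a ((n ∸ k) !) (b * W)) ⟩
      (n ∸ k) ! * (a * (b * W))
        ≡⟨ cong ((n ∸ k) ! *_) (sym (trans (∑-*ˡ (allSubsets n) a _) (cong (a *_) (∑-*ˡ (allSubsets n) b _)))) ⟩
      (n ∸ k) ! * ∑[ V ← allSubsets n ] (a * (b * (⟦ ∣ V ∣ ≟ k ⟧ * 𝟙 (alignedᵇ 0 0 R T V))))
        ∎
      where
      open ≡-Reasoning
      a = ⟦ ∣ R ∣ ≟ r ⟧
      b = ⟦ ∣ T ∣ ≟ k ⟧
      W = ∑[ V ← allSubsets n ] (⟦ ∣ V ∣ ≟ k ⟧ * 𝟙 (alignedᵇ 0 0 R T V))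
      ∣T∣≡k⇒ : ∣ T ∣ ≡ k → ∑[ π ← words n ] (fresh [] π * sortedFixedAlong (restrict T π)) ≡ (n ∸ k) ! * W
      ∣T∣≡k⇒ refl = trans (∑-fresh-restrict [] T sortedFixedAlong)
                          (cong₂ _*_ (nP′n≡n! (n ∸ ∣ T ∣)) (∑-sortedFixedAlong ∣ T ∣))

∑-Sym-count : ∀ n k r → ∑ (Sym n) (count k r) ≡ (n ∸ k) ! * alignedTriples n k r
∑-Sym-count n k r = begin
  ∑ (Sym n) (count k r)
    ≡⟨ ∑-filter injective? (words n) (count k r) ⟩
  ∑[ π ← words n ] (⟦ injective? π ⟧ * count k r π)
    ≡⟨ ∑-cong (words n) (λ π → cong (⟦ injective? π ⟧ *_) (count≡∑ π)) ⟩
  ∑[ π ← words n ] (⟦ injective? π ⟧ * ∑[ R ← S ] ∑[ T ← S ] ⟦ good? k r π (R , T) ⟧)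
    ≡⟨ ∑-cong (words n) (λ π → sym (trans (∑-cong S (λ R → ∑-*ˡ S ⟦ injective? π ⟧ _)) (∑-*ˡ S ⟦ injective? π ⟧ _))) ⟩
  ∑[ π ← words n ] ∑[ R ← S ] ∑[ T ← S ] (⟦ injective? π ⟧ * ⟦ good? k r π (R , T) ⟧)
    ≡⟨ trans (∑-comm (words n) S _) (∑-cong S (λ R → ∑-comm (words n) S _)) ⟩
  ∑[ R ← S ] ∑[ T ← S ] ∑[ π ← words n ] (⟦ injective? π ⟧ * ⟦ good? k r π (R , T) ⟧)
    ≡⟨ ∑-cong S (λ R → ∑-cong S (λ T → ∑-injective-good k r R T)) ⟩
  ∑[ R ← S ] ∑[ T ← S ] ((n ∸ k) ! * ∑[ V ← S ] weight k r R T V)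
    ≡⟨ trans (∑-cong S (λ R → ∑-*ˡ S ((n ∸ k) !) _)) (∑-*ˡ S ((n ∸ k) !) _) ⟩
  (n ∸ k) ! * alignedTriples n k r
    ∎
  where
  open ≡-Reasoning
  S = allSubsets n
  count≡∑ : ∀ π → count k r π ≡ ∑[ R ← S ] ∑[ T ← S ] ⟦ good? k r π (R , T) ⟧
  count≡∑ π = trans (length-filter (good? k r π) (cartesianProduct S S)) (∑-cartesianProduct S S (λ RT → ⟦ good? k r π RT ⟧))

-- A recursion for aligned triples

-- splice u x v is u ++ x ∷ v, typed to avoid casts; it is junk when m = 0 and only used for p < m.
splice : ∀ {A : Set} {m p} → Vec A p → A → Vec A (m ∸ suc p) → Vec A m
splice {m = zero}  _       _ _ = []
splice {m = suc m} []      x v = x ∷ v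
splice {m = suc m} (y ∷ u) x v = y ∷ splice u x v

∑-allSubsets-splice : ∀ {m p} → p < m → (h : Subset m → ℕ) →
  ∑ (allSubsets m) h ≡ ∑[ P ← allSubsets p ] (∑[ S ← allSubsets (m ∸ suc p) ] h (splice P false S)
                                           + ∑[ S ← allSubsets (m ∸ suc p) ] h (splice P true S))
∑-allSubsets-splice {suc m} {zero}  _         h = trans (∑-allSubsets-suc m h) (sym (+-identityʳ _))
∑-allSubsets-splice {suc m} {suc p} (s≤s p<m) h = begin
  ∑ (allSubsets (suc m)) h
    ≡⟨ ∑-allSubsets-suc m h ⟩
  ∑[ V ← allSubsets m ] h (false ∷ V) + ∑[ V ← allSubsets m ] h (true ∷ V)
    ≡⟨ cong₂ _+_ (∑-allSubsets-splice p<m (h ∘ (false ∷_))) (∑-allSubsets-splice p<m (h ∘ (true ∷_))) ⟩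
  ∑[ P ← allSubsets p ] (H (false ∷ P)) + ∑[ P ← allSubsets p ] (H (true ∷ P))
    ≡⟨ ∑-allSubsets-suc p H ⟨
  ∑[ P ← allSubsets (suc p) ] H P
    ∎
  where
  open ≡-Reasoning
  H : Subset (suc p) → ℕ
  H P = ∑[ S ← allSubsets (m ∸ suc p) ] h (splice P false S) + ∑[ S ← allSubsets (m ∸ suc p) ] h (splice P true S)

∑-allSubsets-first : ∀ m (g : Subset m → ℕ) →
  ∑ (allSubsets m) g ≡ g ⊥ + ∑[ p ← upTo m ] ∑[ S ← allSubsets (m ∸ suc p) ] g (splice ⊥ true S)
∑-allSubsets-first zero    g = refl
∑-allSubsets-first (suc m) g = begin
  ∑ (allSubsets (suc m)) g
    ≡⟨ ∑-allSubsets-suc m g ⟩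
  ∑[ V ← allSubsets m ] g (false ∷ V) + A
    ≡⟨ cong (_+ A) (∑-allSubsets-first m (g ∘ (false ∷_))) ⟩
  g ⊥ + B + A
    ≡⟨ +-assoc (g ⊥) B A ⟩
  g ⊥ + (B + A)
    ≡⟨ cong (g ⊥ +_) (+-comm B A) ⟩
  g ⊥ + (A + B)
    ≡⟨ cong (g ⊥ +_) (∑-upTo-suc m (λ p → ∑[ S ← allSubsets (suc m ∸ suc p) ] g (splice ⊥ true S))) ⟨
  g ⊥ + ∑[ p ← upTo (suc m) ] ∑[ S ← allSubsets (suc m ∸ suc p) ] g (splice ⊥ true S)
    ∎
  where
  open ≡-Reasoning
  A = ∑[ V ← allSubsets m ] g (true ∷ V)
  B = ∑[ p ← upTo m ] ∑[ S ← allSubsets (m ∸ suc p) ] g (false ∷ splice ⊥ true S)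

alignedᵇ-shift : ∀ {m} c a b (R T V : Subset m) → alignedᵇ (c + a) (c + b) R T V ≡ alignedᵇ a b R T V
alignedᵇ-shift c a b []      []      []      = refl
alignedᵇ-shift c a b (ρ ∷ R) (t ∷ T) (v ∷ V) =
  cong₂ (λ e rest → (not ρ ∨ (t ∧ v ∧ e)) ∧ rest)
        (does-cong (+-cancelˡ-≡ c a b) (cong (c +_)) (c + a ≟ c + b) (a ≟ b))
        (trans (cong₂ (λ a′ b′ → alignedᵇ a′ b′ R T V) (+-assoc c a (𝟙 t)) (+-assoc c b (𝟙 v)))
               (alignedᵇ-shift c (a + 𝟙 t) (b + 𝟙 v) R T V))

alignedᵇ-diag : ∀ {m} c (R T V : Subset m) → alignedᵇ c c R T V ≡ alignedᵇ 0 0 R T V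
alignedᵇ-diag c R T V =
  trans (cong₂ (λ a b → alignedᵇ a b R T V) (sym (+-identityʳ c)) (sym (+-identityʳ c))) (alignedᵇ-shift c 0 0 R T V)

alignedᵇ-⊥ : ∀ {m} a b (T V : Subset m) → alignedᵇ a b ⊥ T V ≡ true
alignedᵇ-⊥ a b []      []      = refl
alignedᵇ-⊥ a b (t ∷ T) (v ∷ V) = alignedᵇ-⊥ (a + 𝟙 t) (b + 𝟙 v) T V

∣∷∣ : ∀ {m} (x : Bool) (S : Subset m) → ∣ x ∷ S ∣ ≡ 𝟙 x + ∣ S ∣
∣∷∣ true  S = refl
∣∷∣ false S = refl

∣splice∣ : ∀ {m p} → p < m → (P : Subset p) (x : Bool) (S : Subset (m ∸ suc p)) →
           ∣ splice {m = m} P x S ∣ ≡ ∣ P ∣ + ∣ x ∷ S ∣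
∣splice∣ {suc m} _         []      x S = refl
∣splice∣ {suc m} (s≤s p<m) (y ∷ P) x S = begin
  ∣ y ∷ splice {m = m} P x S ∣   ≡⟨ ∣∷∣ y (splice {m = m} P x S) ⟩
  𝟙 y + ∣ splice {m = m} P x S ∣ ≡⟨ cong (𝟙 y +_) (∣splice∣ p<m P x S) ⟩
  𝟙 y + (∣ P ∣ + ∣ x ∷ S ∣)     ≡⟨ +-assoc (𝟙 y) ∣ P ∣ _ ⟨
  𝟙 y + ∣ P ∣ + ∣ x ∷ S ∣       ≡⟨ cong (_+ ∣ x ∷ S ∣) (∣∷∣ y P) ⟨
  ∣ y ∷ P ∣ + ∣ x ∷ S ∣         ∎
  where open ≡-Reasoning

alignedᵇ-splice : ∀ {m p} → p < m → ∀ a b (R T V : Subset (m ∸ suc p)) (P Q : Subset p) (t v : Bool) →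
  alignedᵇ a b (splice {m = m} ⊥ true R) (splice {m = m} P t T) (splice {m = m} Q v V)
  ≡ (t ∧ v ∧ does (a + ∣ P ∣ ≟ b + ∣ Q ∣)) ∧ alignedᵇ (a + ∣ P ∣ + 𝟙 t) (b + ∣ Q ∣ + 𝟙 v) R T V
alignedᵇ-splice {suc m} _ a b R T V [] [] t v
  rewrite +-identityʳ a | +-identityʳ b = refl
alignedᵇ-splice {suc m} (s≤s p<m) a b R T V (y ∷ P) (z ∷ Q) t v =
  trans (alignedᵇ-splice {m} p<m (a + 𝟙 y) (b + 𝟙 z) R T V P Q t v)
        (cong₂ (λ a′ b′ → (t ∧ v ∧ does (a′ ≟ b′)) ∧ alignedᵇ (a′ + 𝟙 t) (b′ + 𝟙 v) R T V) (shift a y P) (shift b z Q))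
  where
  shift : ∀ {p} c (y : Bool) (P : Subset p) → c + 𝟙 y + ∣ P ∣ ≡ c + ∣ y ∷ P ∣
  shift c y P = trans (+-assoc c (𝟙 y) ∣ P ∣) (cong (c +_) (sym (∣∷∣ y P)))

⟦+suc≟⟧ : ∀ a c k → a < k → ⟦ a + suc c ≟ k ⟧ ≡ ⟦ c ≟ k ∸ suc a ⟧
⟦+suc≟⟧ a c k a<k = ⟦⟧-cong
  (λ e → trans (sym (m+n∸m≡n (suc a) c)) (cong (_∸ suc a) (trans (sym (+-suc a c)) e)))
  (λ e → trans (+-suc a c) (trans (cong (suc a +_) e) (m+[n∸m]≡n a<k)))
  (a + suc c ≟ k) (c ≟ k ∸ suc a)

⟦+suc≟⟧-≮ : ∀ a c k → ¬ a < k → ⟦ a + suc c ≟ k ⟧ ≡ 0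
⟦+suc≟⟧-≮ a c k a≮k = ⟦no⟧ (a + suc c ≟ k) (λ e → a≮k (subst (a <_) e (m<m+n a z<s)))

weight-core : ∀ {m} k r a b (R T V : Subset m) →
  ⟦ ∣ R ∣ ≟ r ⟧ * (⟦ a + suc ∣ T ∣ ≟ k ⟧ * (⟦ b + suc ∣ V ∣ ≟ k ⟧ * 𝟙 (does (a ≟ b) ∧ alignedᵇ (a + 1) (b + 1) R T V)))
  ≡ ⟦ a ≟ b ⟧ * (⟦ a <? k ⟧ * weight (k ∸ suc a) r R T V)
weight-core k r a b R T V = split-≟ (a ≟ b)
  where
  split-≟ : (d : Dec (a ≡ b)) →
    ⟦ ∣ R ∣ ≟ r ⟧ * (⟦ a + suc ∣ T ∣ ≟ k ⟧ * (⟦ b + suc ∣ V ∣ ≟ k ⟧ * 𝟙 (does d ∧ alignedᵇ (a + 1) (b + 1) R T V)))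
    ≡ ⟦ d ⟧ * (⟦ a <? k ⟧ * weight (k ∸ suc a) r R T V)
  split-≟ (no _)     = trans (cong (λ u → ⟦ ∣ R ∣ ≟ r ⟧ * (⟦ a + suc ∣ T ∣ ≟ k ⟧ * u)) (*-zeroʳ ⟦ b + suc ∣ V ∣ ≟ k ⟧))
                             (trans (cong (⟦ ∣ R ∣ ≟ r ⟧ *_) (*-zeroʳ ⟦ a + suc ∣ T ∣ ≟ k ⟧)) (*-zeroʳ ⟦ ∣ R ∣ ≟ r ⟧))
  split-≟ (yes refl) = trans (cong (λ M → ⟦ ∣ R ∣ ≟ r ⟧ * (⟦ a + suc ∣ T ∣ ≟ k ⟧ * (⟦ a + suc ∣ V ∣ ≟ k ⟧ * 𝟙 M)))
                                   (alignedᵇ-diag (a + 1) R T V))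
                             (trans (split-<? (a <? k)) (sym (*-identityˡ _)))
    where
    split-<? : (d : Dec (a < k)) →
      ⟦ ∣ R ∣ ≟ r ⟧ * (⟦ a + suc ∣ T ∣ ≟ k ⟧ * (⟦ a + suc ∣ V ∣ ≟ k ⟧ * 𝟙 (alignedᵇ 0 0 R T V)))
      ≡ ⟦ d ⟧ * weight (k ∸ suc a) r R T V
    split-<? (yes a<k) rewrite ⟦+suc≟⟧ a ∣ T ∣ k a<k | ⟦+suc≟⟧ a ∣ V ∣ k a<k = sym (*-identityˡ _)
    split-<? (no  a≮k) rewrite ⟦+suc≟⟧-≮ a ∣ T ∣ k a≮k = *-zeroʳ ⟦ ∣ R ∣ ≟ r ⟧

weight-splice : ∀ {m p} → p < m → ∀ k r (R T V : Subset (m ∸ suc p)) (P Q : Subset p) (t v : Bool) →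
  weight k (suc r) (splice {m = m} ⊥ true R) (splice {m = m} P t T) (splice {m = m} Q v V)
  ≡ 𝟙 (t ∧ v) * (⟦ ∣ P ∣ ≟ ∣ Q ∣ ⟧ * (⟦ ∣ P ∣ <? k ⟧ * weight (k ∸ suc ∣ P ∣) r R T V))
weight-splice {m} {p} p<m k r R T V P Q t v rewrite alignedᵇ-splice p<m 0 0 R T V P Q t v = cases t v
  where
  x*[y*[z*0]]≡0 : ∀ x y z → x * (y * (z * 0)) ≡ 0
  x*[y*[z*0]]≡0 x y z = trans (cong (λ u → x * (y * u)) (*-zeroʳ z)) (trans (cong (x *_) (*-zeroʳ y)) (*-zeroʳ x))
  cT cV : Bool → ℕ
  cT t = ⟦ ∣ splice {m = m} P t T ∣ ≟ k ⟧
  cV v = ⟦ ∣ splice {m = m} Q v V ∣ ≟ k ⟧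
  cases : ∀ t v →
    ⟦ ∣ splice {m = m} ⊥ true R ∣ ≟ suc r ⟧ * (cT t * (cV v * 𝟙 ((t ∧ v ∧ does (∣ P ∣ ≟ ∣ Q ∣)) ∧ alignedᵇ (∣ P ∣ + 𝟙 t) (∣ Q ∣ + 𝟙 v) R T V)))
    ≡ 𝟙 (t ∧ v) * (⟦ ∣ P ∣ ≟ ∣ Q ∣ ⟧ * (⟦ ∣ P ∣ <? k ⟧ * weight (k ∸ suc ∣ P ∣) r R T V))
  cases false v     = x*[y*[z*0]]≡0 ⟦ ∣ splice {m = m} ⊥ true R ∣ ≟ suc r ⟧ (cT false) (cV v)
  cases true  false = x*[y*[z*0]]≡0 ⟦ ∣ splice {m = m} ⊥ true R ∣ ≟ suc r ⟧ (cT true) (cV false)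
  cases true  true
    rewrite ∣splice∣ p<m ⊥ true R | ∣⊥∣≡0 p | ∣splice∣ p<m P true T | ∣splice∣ p<m Q true V =
      trans (weight-core k r ∣ P ∣ ∣ Q ∣ R T V) (sym (*-identityˡ _))

x*x≡x^2 : ∀ x → x * x ≡ x ^ 2
x*x≡x^2 x = cong (x *_) (sym (*-identityʳ x))

module _ {m p : ℕ} (p<m : p < m) (k r : ℕ) (R : Subset (m ∸ suc p)) where

  private
    q = m ∸ suc p
    w : Subset m → Subset m → ℕ
    w = weight k (suc r) (splice {m = m} ⊥ true R)
    X : Subset p → Subset p → Subset q → Subset q → ℕ
    X P Q T V = ⟦ ∣ P ∣ ≟ ∣ Q ∣ ⟧ * (⟦ ∣ P ∣ <? k ⟧ * weight (k ∸ suc ∣ P ∣) r R T V)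

  ∑-weight-splice : ∀ (P : Subset p) t (T : Subset q) →
    ∑[ V ← allSubsets m ] w (splice {m = m} P t T) V ≡ 𝟙 t * ∑[ Q ← allSubsets p ] ∑[ V ← allSubsets q ] X P Q T V
  ∑-weight-splice P t T = begin
    ∑[ V ← allSubsets m ] w (splice {m = m} P t T) V
      ≡⟨ ∑-allSubsets-splice p<m _ ⟩
    ∑[ Q ← allSubsets p ] (∑[ V ← allSubsets q ] w (splice {m = m} P t T) (splice {m = m} Q false V)
                          + ∑[ V ← allSubsets q ] w (splice {m = m} P t T) (splice {m = m} Q true V))
      ≡⟨ ∑-cong (allSubsets p) (λ Q → cong₂ _+_
           (∑-zero (allSubsets q) (λ V → trans (weight-splice p<m k r R T V P Q t false) (cong (λ b → 𝟙 b * X P Q T V) (∧-zeroʳ t))))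
           (∑-cong (allSubsets q) (λ V → trans (weight-splice p<m k r R T V P Q t true) (cong (λ b → 𝟙 b * X P Q T V) (∧-identityʳ t))))) ⟩
    ∑[ Q ← allSubsets p ] (0 + ∑[ V ← allSubsets q ] (𝟙 t * X P Q T V))
      ≡⟨ ∑-cong (allSubsets p) (λ Q → ∑-*ˡ (allSubsets q) (𝟙 t) _) ⟩
    ∑[ Q ← allSubsets p ] (𝟙 t * ∑[ V ← allSubsets q ] X P Q T V)
      ≡⟨ ∑-*ˡ (allSubsets p) (𝟙 t) _ ⟩
    𝟙 t * ∑[ Q ← allSubsets p ] ∑[ V ← allSubsets q ] X P Q T V
      ∎
    where open ≡-Reasoning

  alignedPairs-firstAt : alignedPairs k (suc r) (splice {m = m} ⊥ true R)
    ≡ ∑[ P ← allSubsets p ] ∑[ Q ← allSubsets p ] (⟦ ∣ P ∣ ≟ ∣ Q ∣ ⟧ * (⟦ ∣ P ∣ <? k ⟧ * alignedPairs (k ∸ suc ∣ P ∣) r R))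
  alignedPairs-firstAt = begin
    ∑[ T ← allSubsets m ] ∑[ V ← allSubsets m ] w T V
      ≡⟨ ∑-allSubsets-splice p<m _ ⟩
    ∑[ P ← allSubsets p ] (∑[ T ← allSubsets q ] ∑[ V ← allSubsets m ] w (splice {m = m} P false T) V
                          + ∑[ T ← allSubsets q ] ∑[ V ← allSubsets m ] w (splice {m = m} P true T) V)
      ≡⟨ ∑-cong (allSubsets p) (λ P → cong₂ _+_ (∑-zero (allSubsets q) (∑-weight-splice P false))
                                                 (∑-cong (allSubsets q) (λ T → trans (∑-weight-splice P true T) (*-identityˡ _)))) ⟩
    ∑[ P ← allSubsets p ] ∑[ T ← allSubsets q ] ∑[ Q ← allSubsets p ] ∑[ V ← allSubsets q ] X P Q T V
      ≡⟨ ∑-cong (allSubsets p) (λ P → ∑-comm (allSubsets q) (allSubsets p) _) ⟩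
    ∑[ P ← allSubsets p ] ∑[ Q ← allSubsets p ] ∑[ T ← allSubsets q ] ∑[ V ← allSubsets q ] X P Q T V
      ≡⟨ ∑-cong (allSubsets p) (λ P → ∑-cong (allSubsets p) (λ Q → pull P Q)) ⟩
    ∑[ P ← allSubsets p ] ∑[ Q ← allSubsets p ] (⟦ ∣ P ∣ ≟ ∣ Q ∣ ⟧ * (⟦ ∣ P ∣ <? k ⟧ * alignedPairs (k ∸ suc ∣ P ∣) r R))
      ∎
    where
    open ≡-Reasoning
    pull : ∀ P Q → ∑[ T ← allSubsets q ] ∑[ V ← allSubsets q ] X P Q T V
                 ≡ ⟦ ∣ P ∣ ≟ ∣ Q ∣ ⟧ * (⟦ ∣ P ∣ <? k ⟧ * alignedPairs (k ∸ suc ∣ P ∣) r R)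
    pull P Q = trans (∑∑-*ˡ (allSubsets q) (allSubsets q) ⟦ ∣ P ∣ ≟ ∣ Q ∣ ⟧ _)
                     (cong (⟦ ∣ P ∣ ≟ ∣ Q ∣ ⟧ *_) (∑∑-*ˡ (allSubsets q) (allSubsets q) ⟦ ∣ P ∣ <? k ⟧ _))

∑-alignedPairs-firstAt : ∀ {m p} → p < m → ∀ k r →
  ∑[ S ← allSubsets (m ∸ suc p) ] alignedPairs k (suc r) (splice {m = m} ⊥ true S)
  ≡ ∑[ j ← upTo k ] ((p C j) ^ 2 * alignedTriples (m ∸ suc p) (k ∸ suc j) r)
∑-alignedPairs-firstAt {m} {p} p<m k r = begin
  ∑[ S ← allSubsets q ] alignedPairs k (suc r) (splice {m = m} ⊥ true S)
    ≡⟨ ∑-cong (allSubsets q) (alignedPairs-firstAt p<m k r) ⟩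
  ∑[ S ← allSubsets q ] ∑[ P ← allSubsets p ] ∑[ Q ← allSubsets p ] (⟦ ∣ P ∣ ≟ ∣ Q ∣ ⟧ * (⟦ ∣ P ∣ <? k ⟧ * alignedPairs (k ∸ suc ∣ P ∣) r S))
    ≡⟨ trans (∑-comm (allSubsets q) (allSubsets p) _) (∑-cong (allSubsets p) (λ P → ∑-comm (allSubsets q) (allSubsets p) _)) ⟩
  ∑[ P ← allSubsets p ] ∑[ Q ← allSubsets p ] ∑[ S ← allSubsets q ] (⟦ ∣ P ∣ ≟ ∣ Q ∣ ⟧ * (⟦ ∣ P ∣ <? k ⟧ * alignedPairs (k ∸ suc ∣ P ∣) r S))
    ≡⟨ ∑-cong (allSubsets p) (λ P → ∑-cong (allSubsets p) (λ Q →
         trans (∑-*ˡ (allSubsets q) ⟦ ∣ P ∣ ≟ ∣ Q ∣ ⟧ _) (cong (⟦ ∣ P ∣ ≟ ∣ Q ∣ ⟧ *_) (∑-*ˡ (allSubsets q) ⟦ ∣ P ∣ <? k ⟧ _)))) ⟩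
  ∑[ P ← allSubsets p ] ∑[ Q ← allSubsets p ] (⟦ ∣ P ∣ ≟ ∣ Q ∣ ⟧ * (⟦ ∣ P ∣ <? k ⟧ * A ∣ P ∣))
    ≡⟨ ∑-cong (allSubsets p) (λ P → trans (∑-*ʳ (allSubsets p) (⟦ ∣ P ∣ <? k ⟧ * A ∣ P ∣) _) (cong (_* (⟦ ∣ P ∣ <? k ⟧ * A ∣ P ∣)) (∑-same-size P))) ⟩
  ∑[ P ← allSubsets p ] ((p C ∣ P ∣) * (⟦ ∣ P ∣ <? k ⟧ * A ∣ P ∣))
    ≡⟨ ∑-cong (allSubsets p) (λ P → x*[y*z]≡y*[x*z] (p C ∣ P ∣) ⟦ ∣ P ∣ <? k ⟧ (A ∣ P ∣)) ⟩
  ∑[ P ← allSubsets p ] (⟦ ∣ P ∣ <? k ⟧ * ((p C ∣ P ∣) * A ∣ P ∣))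
    ≡⟨ ∑-allSubsets-card p k (λ j → (p C j) * A j) ⟩
  ∑[ j ← upTo k ] ((p C j) * ((p C j) * A j))
    ≡⟨ ∑-cong (upTo k) (λ j → trans (sym (*-assoc (p C j) (p C j) (A j))) (cong (_* A j) (x*x≡x^2 (p C j)))) ⟩
  ∑[ j ← upTo k ] ((p C j) ^ 2 * A j)
    ∎
  where
  open ≡-Reasoning
  q = m ∸ suc p
  A : ℕ → ℕ
  A j = alignedTriples q (k ∸ suc j) r
  ∑-same-size : ∀ P → ∑[ Q ← allSubsets p ] ⟦ ∣ P ∣ ≟ ∣ Q ∣ ⟧ ≡ p C ∣ P ∣
  ∑-same-size P = trans (∑-cong (allSubsets p) (λ Q → ⟦⟧-cong sym sym (∣ P ∣ ≟ ∣ Q ∣) (∣ Q ∣ ≟ ∣ P ∣))) (∑-allSubsets-count p ∣ P ∣)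

alignedTriples-suc : ∀ m k r →
  alignedTriples m k (suc r) ≡ ∑[ p ← upTo m ] ∑[ j ← upTo k ] ((p C j) ^ 2 * alignedTriples (m ∸ suc p) (k ∸ suc j) r)
alignedTriples-suc m k r = begin
  ∑[ R ← allSubsets m ] alignedPairs k (suc r) R
    ≡⟨ ∑-allSubsets-first m (alignedPairs k (suc r)) ⟩
  alignedPairs {m} k (suc r) ⊥ + ∑[ p ← upTo m ] ∑[ S ← allSubsets (m ∸ suc p) ] alignedPairs k (suc r) (splice {m = m} ⊥ true S)
    ≡⟨ cong₂ _+_ alignedPairs-⊥ (∑-cong-∈ (upTo m) (λ p∈ → ∑-alignedPairs-firstAt {m} (∈-upTo⁻ p∈) k r)) ⟩
  ∑[ p ← upTo m ] ∑[ j ← upTo k ] ((p C j) ^ 2 * alignedTriples (m ∸ suc p) (k ∸ suc j) r)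
    ∎
  where
  open ≡-Reasoning
  alignedPairs-⊥ : alignedPairs {m} k (suc r) ⊥ ≡ 0
  alignedPairs-⊥ rewrite ∣⊥∣≡0 m = ∑-zero (allSubsets m) (λ T → ∑-zero (allSubsets m) (λ V → refl))

alignedTriples-zero : ∀ m k → alignedTriples m k 0 ≡ (m C k) ^ 2
alignedTriples-zero m k = begin
  ∑[ R ← S ] ∑[ T ← S ] ∑[ V ← S ] weight k 0 R T V
    ≡⟨ ∑-cong S (λ R → ∑∑-*ˡ S S ⟦ ∣ R ∣ ≟ 0 ⟧ _) ⟩
  ∑[ R ← S ] (⟦ ∣ R ∣ ≟ 0 ⟧ * ∑[ T ← S ] ∑[ V ← S ] (⟦ ∣ T ∣ ≟ k ⟧ * (⟦ ∣ V ∣ ≟ k ⟧ * 𝟙 (alignedᵇ 0 0 R T V))))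
    ≡⟨ ∑-allSubsets-empty m _ ⟩
  ∑[ T ← S ] ∑[ V ← S ] (⟦ ∣ T ∣ ≟ k ⟧ * (⟦ ∣ V ∣ ≟ k ⟧ * 𝟙 (alignedᵇ 0 0 ⊥ T V)))
    ≡⟨ ∑-cong S (λ T → trans (∑-cong S (λ V → cong (λ b → ⟦ ∣ T ∣ ≟ k ⟧ * (⟦ ∣ V ∣ ≟ k ⟧ * 𝟙 b)) (alignedᵇ-⊥ 0 0 T V)))
                             (∑-*ˡ S ⟦ ∣ T ∣ ≟ k ⟧ _)) ⟩
  ∑[ T ← S ] (⟦ ∣ T ∣ ≟ k ⟧ * ∑[ V ← S ] (⟦ ∣ V ∣ ≟ k ⟧ * 1))
    ≡⟨ ∑-*ʳ S _ (λ T → ⟦ ∣ T ∣ ≟ k ⟧) ⟩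
  ∑[ T ← S ] ⟦ ∣ T ∣ ≟ k ⟧ * ∑[ V ← S ] (⟦ ∣ V ∣ ≟ k ⟧ * 1)
    ≡⟨ cong₂ _*_ (∑-allSubsets-count m k) (trans (∑-cong S (λ V → *-identityʳ _)) (∑-allSubsets-count m k)) ⟩
  (m C k) * (m C k)
    ≡⟨ x*x≡x^2 (m C k) ⟩
  (m C k) ^ 2
    ∎
  where
  open ≡-Reasoning
  S = allSubsets m

-- The same recursion for the composition sum

∑-compositions-suc : ∀ p N (f : Vec ℕ (suc p) → ℕ) →
  ∑ (compositions (suc p) N) f ≡ ∑[ a ← upTo (suc N) ] ∑[ ns ← compositions p (N ∸ a) ] f (a ∷ ns)
∑-compositions-suc p N f = trans (∑-concatMap (λ a → map (a ∷_) (compositions p (N ∸ a))) (upTo (suc N)) f)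
                                 (∑-cong (upTo (suc N)) (λ a → ∑-map (a ∷_) (compositions p (N ∸ a)) f))

compositionSum : ℕ → ℕ → ℕ → ℕ
compositionSum p N K = ∑[ ns ← compositions p N ] ∑[ ks ← compositions p K ] prodBinom² ns ks

compositionSum-suc : ∀ p N K →
  compositionSum (suc p) N K ≡ ∑[ a ← upTo (suc N) ] ∑[ b ← upTo (suc K) ] ((a C b) ^ 2 * compositionSum p (N ∸ a) (K ∸ b))
compositionSum-suc p N K = begin
  compositionSum (suc p) N K
    ≡⟨ ∑-compositions-suc p N _ ⟩
  ∑[ a ← upTo (suc N) ] ∑[ ns ← compositions p (N ∸ a) ] ∑[ ks ← compositions (suc p) K ] prodBinom² (a ∷ ns) ks
    ≡⟨ ∑-cong (upTo (suc N)) (λ a → ∑-cong (compositions p (N ∸ a)) (λ ns → split-ks a ns)) ⟩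
  ∑[ a ← upTo (suc N) ] ∑[ ns ← compositions p (N ∸ a) ] ∑[ b ← upTo (suc K) ] ((a C b) ^ 2 * ∑[ ks ← compositions p (K ∸ b) ] prodBinom² ns ks)
    ≡⟨ ∑-cong (upTo (suc N)) (λ a → ∑-comm (compositions p (N ∸ a)) (upTo (suc K)) _) ⟩
  ∑[ a ← upTo (suc N) ] ∑[ b ← upTo (suc K) ] ∑[ ns ← compositions p (N ∸ a) ] ((a C b) ^ 2 * ∑[ ks ← compositions p (K ∸ b) ] prodBinom² ns ks)
    ≡⟨ ∑-cong (upTo (suc N)) (λ a → ∑-cong (upTo (suc K)) (λ b → ∑-*ˡ (compositions p (N ∸ a)) ((a C b) ^ 2) _)) ⟩
  ∑[ a ← upTo (suc N) ] ∑[ b ← upTo (suc K) ] ((a C b) ^ 2 * compositionSum p (N ∸ a) (K ∸ b))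
    ∎
  where
  open ≡-Reasoning
  split-ks : ∀ a ns → ∑[ ks ← compositions (suc p) K ] prodBinom² (a ∷ ns) ks
                    ≡ ∑[ b ← upTo (suc K) ] ((a C b) ^ 2 * ∑[ ks ← compositions p (K ∸ b) ] prodBinom² ns ks)
  split-ks a ns = trans (∑-compositions-suc p K _)
                        (∑-cong (upTo (suc K)) (λ b → ∑-*ˡ (compositions p (K ∸ b)) ((a C b) ^ 2) (prodBinom² ns)))

compositionSum-zero : ∀ N K → compositionSum 0 N K ≡ ⟦ N ≟ 0 ⟧ * ⟦ K ≟ 0 ⟧
compositionSum-zero zero    zero    = refl
compositionSum-zero zero    (suc K) = refl
compositionSum-zero (suc N) K       = refl

⟦∸≟0⟧ : ∀ {a} N → a ≤ N → ⟦ N ∸ a ≟ 0 ⟧ ≡ ⟦ N ≟ a ⟧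
⟦∸≟0⟧ {a} N a≤N = ⟦⟧-cong (λ e → trans (sym (m∸n+n≡m a≤N)) (cong (_+ a) e)) (λ e → trans (cong (_∸ a) e) (n∸n≡0 a))
                          (N ∸ a ≟ 0) (N ≟ a)

compositionSum-one : ∀ N K → compositionSum 1 N K ≡ (N C K) ^ 2
compositionSum-one N K = begin
  compositionSum 1 N K
    ≡⟨ compositionSum-suc 0 N K ⟩
  ∑[ a ← upTo (suc N) ] ∑[ b ← upTo (suc K) ] ((a C b) ^ 2 * compositionSum 0 (N ∸ a) (K ∸ b))
    ≡⟨ ∑-cong-∈ (upTo (suc N)) (λ a∈ → ∑-cong-∈ (upTo (suc K)) (λ b∈ → as-δ (∈-upTo⁻ a∈) (∈-upTo⁻ b∈))) ⟩
  ∑[ a ← upTo (suc N) ] ∑[ b ← upTo (suc K) ] (⟦ N ≟ a ⟧ * (⟦ K ≟ b ⟧ * (a C b) ^ 2))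
    ≡⟨ ∑-cong (upTo (suc N)) (λ a → trans (∑-*ˡ (upTo (suc K)) ⟦ N ≟ a ⟧ _) (cong (⟦ N ≟ a ⟧ *_) (δ K (λ b → (a C b) ^ 2)))) ⟩
  ∑[ a ← upTo (suc N) ] (⟦ N ≟ a ⟧ * (a C K) ^ 2)
    ≡⟨ δ N (λ a → (a C K) ^ 2) ⟩
  (N C K) ^ 2
    ∎
  where
  open ≡-Reasoning
  as-δ : ∀ {a b} → a < suc N → b < suc K →
         (a C b) ^ 2 * compositionSum 0 (N ∸ a) (K ∸ b) ≡ ⟦ N ≟ a ⟧ * (⟦ K ≟ b ⟧ * (a C b) ^ 2)
  as-δ {a} {b} (s≤s a≤N) (s≤s b≤K) =
    trans (cong ((a C b) ^ 2 *_) (trans (compositionSum-zero (N ∸ a) (K ∸ b)) (cong₂ _*_ (⟦∸≟0⟧ N a≤N) (⟦∸≟0⟧ K b≤K))))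
          (trans (*-comm ((a C b) ^ 2) _) (*-assoc ⟦ N ≟ a ⟧ ⟦ K ≟ b ⟧ _))
  δ : ∀ c (f : ℕ → ℕ) → ∑[ j ← upTo (suc c) ] (⟦ c ≟ j ⟧ * f j) ≡ f c
  δ c f = trans (∑-upTo-δ (suc c) c f) (trans (cong (_* f c) (⟦yes⟧ (c <? suc c) ≤-refl)) (*-identityˡ (f c)))

compositionsSub-+ : ∀ p r N → compositionsSub p (r + N) r ≡ compositions p N
compositionsSub-+ p r N with r ≤ᵇ r + N | ≤⇒≤ᵇ (m≤m+n r N)
... | true | _ = cong (compositions p) (m+n∸m≡n r N)

compositionsSub-< : ∀ p {m r} → m < r → compositionsSub p m r ≡ []
compositionsSub-< p {m} {r} m<r with r ≤ᵇ m in r≤ᵇm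
... | true  = contradiction (≤ᵇ⇒≤ r m (subst IsTrue (sym r≤ᵇm) tt)) (<⇒≱ m<r)
... | false = refl

RHSsum-+ : ∀ r N K → RHSsum (r + N) (r + K) r ≡ compositionSum (suc r) N K
RHSsum-+ r N K = cong₂ (λ A B → ∑[ ns ← A ] ∑[ ks ← B ] prodBinom² ns ks) (compositionsSub-+ (suc r) r N) (compositionsSub-+ (suc r) r K)

RHSsum-<ˡ : ∀ {m r} k → m < r → RHSsum m k r ≡ 0
RHSsum-<ˡ {m} {r} k m<r = cong (λ A → ∑[ ns ← A ] ∑[ ks ← compositionsSub (suc r) k r ] prodBinom² ns ks) (compositionsSub-< (suc r) m<r)

RHSsum-<ʳ : ∀ m {k r} → k < r → RHSsum m k r ≡ 0
RHSsum-<ʳ m {k} {r} k<r = trans (cong (λ B → ∑[ ns ← compositionsSub (suc r) m r ] ∑[ ks ← B ] prodBinom² ns ks) (compositionsSub-< (suc r) k<r))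
                                (∑-zero (compositionsSub (suc r) m r) (λ _ → refl))

RHSsum-zero : ∀ m k → RHSsum m k 0 ≡ (m C k) ^ 2
RHSsum-zero = compositionSum-one

∸-suc-< : ∀ x y r → x ≤ y + r → y < x → x ∸ suc y < r
∸-suc-< (suc x) zero    r x≤r       _         = x≤r
∸-suc-< (suc x) (suc y) r (s≤s x≤y+r) (s≤s y<x) = ∸-suc-< x y r x≤y+r y<x

module _ (r : ℕ) where

  private
    term : ℕ → ℕ → ℕ → ℕ → ℕ
    term m k p j = (p C j) ^ 2 * RHSsum (m ∸ suc p) (k ∸ suc j) r

    beyond : ∀ X {a} → X < a → suc r + X ≤ a + r
    beyond X {a} X<a = subst (_≤ a + r) (cong suc (+-comm X r)) (+-monoˡ-≤ r X<a)

    term-vanishesˡ : ∀ {m} k {p} j → m ≤ p + r → p < m → term m k p j ≡ 0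
    term-vanishesˡ {m} k {p} j m≤p+r p<m = trans (cong ((p C j) ^ 2 *_) (RHSsum-<ˡ (k ∸ suc j) (∸-suc-< m p r m≤p+r p<m))) (*-zeroʳ ((p C j) ^ 2))

    term-vanishesʳ : ∀ m {k} p {j} → k ≤ j + r → j < k → term m k p j ≡ 0
    term-vanishesʳ m {k} p {j} k≤j+r j<k = trans (cong ((p C j) ^ 2 *_) (RHSsum-<ʳ (m ∸ suc p) (∸-suc-< k j r k≤j+r j<k))) (*-zeroʳ ((p C j) ^ 2))

  RHSsum-suc-+ : ∀ N K → RHSsum (suc r + N) (suc r + K) (suc r)
               ≡ ∑[ p ← upTo (suc r + N) ] ∑[ j ← upTo (suc r + K) ] term (suc r + N) (suc r + K) p j
  RHSsum-suc-+ N K = begin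
    RHSsum (suc r + N) (suc r + K) (suc r)
      ≡⟨ RHSsum-+ (suc r) N K ⟩
    compositionSum (suc (suc r)) N K
      ≡⟨ compositionSum-suc (suc r) N K ⟩
    ∑[ a ← upTo (suc N) ] ∑[ b ← upTo (suc K) ] ((a C b) ^ 2 * compositionSum (suc r) (N ∸ a) (K ∸ b))
      ≡⟨ ∑-cong-∈ (upTo (suc N)) (λ {a} a∈ → ∑-cong-∈ (upTo (suc K)) (λ {b} b∈ → cong ((a C b) ^ 2 *_)
           (sym (as-RHSsum (≤-pred (∈-upTo⁻ a∈)) (≤-pred (∈-upTo⁻ b∈)))))) ⟩
    ∑[ a ← upTo (suc N) ] ∑[ b ← upTo (suc K) ] term M L a b
      ≡⟨ ∑-cong (upTo (suc N)) (λ a → ∑-upTo-≤ (term M L a) (s≤s (m≤n+m K r)) (λ K<b b<L → term-vanishesʳ M a (beyond K K<b) b<L)) ⟨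
    ∑[ a ← upTo (suc N) ] ∑[ b ← upTo L ] term M L a b
      ≡⟨ ∑-upTo-≤ (λ a → ∑[ b ← upTo L ] term M L a b) (s≤s (m≤n+m N r))
           (λ N<a a<M → ∑-zero (upTo L) (λ b → term-vanishesˡ L b (beyond N N<a) a<M)) ⟨
    ∑[ a ← upTo M ] ∑[ b ← upTo L ] term M L a b
      ∎
    where
    open ≡-Reasoning
    M = suc r + N
    L = suc r + K
    as-RHSsum : ∀ {a b} → a ≤ N → b ≤ K → RHSsum (M ∸ suc a) (L ∸ suc b) r ≡ compositionSum (suc r) (N ∸ a) (K ∸ b)
    as-RHSsum {a} {b} a≤N b≤K = trans (cong₂ (λ x y → RHSsum x y r) (+-∸-assoc r a≤N) (+-∸-assoc r b≤K)) (RHSsum-+ r (N ∸ a) (K ∸ b))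

  RHSsum-suc : ∀ m k → RHSsum m k (suc r) ≡ ∑[ p ← upTo m ] ∑[ j ← upTo k ] ((p C j) ^ 2 * RHSsum (m ∸ suc p) (k ∸ suc j) r)
  RHSsum-suc m k with suc r ≤? m | suc r ≤? k
  ... | yes r<m | yes r<k with m≤n⇒∃[o]m+o≡n r<m | m≤n⇒∃[o]m+o≡n r<k
  ...   | N , refl | K , refl = RHSsum-suc-+ N K
  RHSsum-suc m k | no r≮m | _ = trans (RHSsum-<ˡ k (≰⇒> r≮m)) (sym (∑-zero-∈ (upTo m) (λ {p} p∈ → ∑-zero (upTo k)
    (λ j → term-vanishesˡ k j (≤-trans (≤-pred (≰⇒> r≮m)) (m≤n+m r p)) (∈-upTo⁻ p∈)))))
  RHSsum-suc m k | yes _ | no r≮k = trans (RHSsum-<ʳ m (≰⇒> r≮k)) (sym (∑-zero (upTo m) (λ p → ∑-zero-∈ (upTo k)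
    (λ {j} j∈ → term-vanishesʳ m p (≤-trans (≤-pred (≰⇒> r≮k)) (m≤n+m r j)) (∈-upTo⁻ j∈)))))

alignedTriples≡RHSsum : ∀ r m k → alignedTriples m k r ≡ RHSsum m k r
alignedTriples≡RHSsum zero    m k = trans (alignedTriples-zero m k) (sym (RHSsum-zero m k))
alignedTriples≡RHSsum (suc r) m k = begin
  alignedTriples m k (suc r)
    ≡⟨ alignedTriples-suc m k r ⟩
  ∑[ p ← upTo m ] ∑[ j ← upTo k ] ((p C j) ^ 2 * alignedTriples (m ∸ suc p) (k ∸ suc j) r)
    ≡⟨ ∑-cong (upTo m) (λ p → ∑-cong (upTo k) (λ j → cong ((p C j) ^ 2 *_) (alignedTriples≡RHSsum r (m ∸ suc p) (k ∸ suc j)))) ⟩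
  ∑[ p ← upTo m ] ∑[ j ← upTo k ] ((p C j) ^ 2 * RHSsum (m ∸ suc p) (k ∸ suc j) r)
    ≡⟨ RHSsum-suc r m k ⟨
  RHSsum m k (suc r)
    ∎
  where open ≡-Reasoning

-- Imported only here: _P_ and the prefix +_ would make P and sections (x +_) ambiguous above.
open import Data.Nat.Combinatorics using (_P_; k![n∸k]!∣n!)
open import Data.Nat.Combinatorics.Specification using (nPk≡n!/[n∸k]!)
open import Data.Nat.DivMod using (m/n*n≡m)
open import Data.Nat.Divisibility using (∣-trans; n∣m*n)

nPk*[n∸k]!≡n! : ∀ {n k} → k ≤ n → (n P k) * (n ∸ k) ! ≡ n !
nPk*[n∸k]!≡n! {n} {k} k≤n = trans (cong (_* (n ∸ k) !) (nPk≡n!/[n∸k]! k≤n))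
                                  (m/n*n≡m {{(n ∸ k) !≢0}} (∣-trans (n∣m*n (k !)) (k![n∸k]!∣n! k≤n)))

open import Data.Integer using (+_)
import Data.Integer.Properties as ℤ
open import Data.Rational using (_/_)
open import Data.Rational.Properties using (fromℚᵘ-cong)
open import Data.Rational.Unnormalised using (mkℚᵘ; *≡*)

/-cross : ∀ a b c d .{{_ : NonZero c}} .{{_ : NonZero d}} → a * d ≡ b * c → ((+ a) / c) ≡ ((+ b) / d)
/-cross a b (suc c) (suc d) eq =
  fromℚᵘ-cong {mkℚᵘ (+ a) c} {mkℚᵘ (+ b) d} (*≡* (trans (sym (ℤ.pos-* a (suc d))) (trans (cong +_ eq) (ℤ.pos-* b (suc c)))))

lemma2p11 : (n k r : ℕ) → (k≤n : k ≤ n) →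
    E n k r ≡ ((+ RHSsum n k r) / (n P k)) {{P≢0 k≤n}}
lemma2p11 n k r k≤n = /-cross (∑ (Sym n) (count k r)) (RHSsum n k r) (n !) (n P k) {{n !≢0}} {{P≢0 k≤n}} (begin
  ∑ (Sym n) (count k r) * (n P k)             ≡⟨ cong (_* (n P k)) (∑-Sym-count n k r) ⟩
  (n ∸ k) ! * alignedTriples n k r * (n P k)  ≡⟨ cong (λ x → (n ∸ k) ! * x * (n P k)) (alignedTriples≡RHSsum r n k) ⟩
  (n ∸ k) ! * RHSsum n k r * (n P k)          ≡⟨ cong (_* (n P k)) (*-comm ((n ∸ k) !) (RHSsum n k r)) ⟩
  RHSsum n k r * (n ∸ k) ! * (n P k)          ≡⟨ *-assoc (RHSsum n k r) ((n ∸ k) !) (n P k) ⟩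
  RHSsum n k r * ((n ∸ k) ! * (n P k))        ≡⟨ cong (RHSsum n k r *_) (trans (*-comm ((n ∸ k) !) (n P k)) (nPk*[n∸k]!≡n! k≤n)) ⟩
  RHSsum n k r * n !                          ∎)
  where open ≡-Reasoning
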